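{- Let $n$ be even with $n > 2$, let $k$ be odd with $n-1 \le k \le 2n-3$, and set $n' = n/2$, $k' = (k+1)/2$. Then $$s_2(n,k) = n' \cdot f_{n'+1,k'},$$ where $s_2(n,k)$ is the number of non-crossing connected graphs on $n$ vertices with $k$ edges fixed under rotation by $\pi$, and $f_{m,j}$ is the number of non-crossing connected graphs on $\{1,\ldots,m\}$ with $j$ edges that contain the edge from $1$ to $m$.
   Context: A non-crossing graph on $\{1,\ldots,m\}$ is a simple graph whose vertices $1,\ldots,m$ are placed in order around a circle, edges drawn as straight chords, with no two edges crossing. Rotation by $\pi$ on $n$ vertices ($n$ even) sends vertex $i$ to $i+n/2$ modulo $n$. -}

module Defs where

open import Data.Bool using (Bool; true; false; _∧_; _∨_; not; if_then_else_)
open import Data.Nat using (ℕ; zero; suc; _+_; _<ᵇ_; _≡ᵇ_; _/_)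
open import Data.Nat.DivMod using (_mod_)
open import Data.Fin using (Fin; toℕ; zero; fromℕ)
open import Data.Vec using (Vec; []; _∷_; lookup)
open import Data.List using (List; []; _∷_; map; concatMap; allFin)
open import Data.Bool.ListAction using (all; any)
open import Data.Nat.ListAction using (sum)

-- Vertices of a graph on m points are Fin m = {0,…,m-1}, placed in this
-- cyclic order around a circle (vertex i here is vertex i+1 of the paper).
-- A graph is given by its adjacency matrix.
Graph : ℕ → Set
Graph m = Vec (Vec Bool m) m

adj : ∀ {m} → Graph m → Fin m → Fin m → Bool
adj g i j = lookup (lookup g i) j

allF : ∀ m → (Fin m → Bool) → Bool
allF m p = all p (allFin m)

anyF : ∀ m → (Fin m → Bool) → Bool
anyF m p = any p (allFin m)

_⇔ᵇ_ : Bool → Bool → Bool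
true  ⇔ᵇ b = b
false ⇔ᵇ b = not b

_<F_ : ∀ {m} → Fin m → Fin m → Bool
i <F j = toℕ i <ᵇ toℕ j

_≡F_ : ∀ {m} → Fin m → Fin m → Bool
i ≡F j = toℕ i ≡ᵇ toℕ j

isSimple : ∀ {m} → Graph m → Bool
isSimple {m} g = allF m λ i → not (adj g i i) ∧ allF m λ j → adj g i j ⇔ᵇ adj g j i

isNonCrossing : ∀ {m} → Graph m → Bool
isNonCrossing {m} g =
  allF m λ a → allF m λ b → allF m λ c → allF m λ d →
    not (adj g a b ∧ adj g c d ∧ (a <F c) ∧ (c <F b) ∧ (b <F d))

countB : ∀ {A : Set} → (A → Bool) → List A → ℕ
countB p [] = 0
countB p (x ∷ xs) = if p x then suc (countB p xs) else countB p xs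

numEdges : ∀ {m} → Graph m → ℕ
numEdges {m} g = sum (map (λ i → countB (λ j → (i <F j) ∧ adj g i j) (allFin m)) (allFin m))

reach : ∀ {m} → Graph m → ℕ → Fin m → Fin m → Bool
reach g zero    u v = u ≡F v
reach {m} g (suc t) u v = reach g t u v ∨ anyF m (λ w → reach g t u w ∧ adj g w v)

-- connected: every two vertices are joined by a walk (a walk can always be
-- shortened to a path, which has fewer than m edges, so bound m suffices)
isConnected : ∀ {m} → Graph m → Bool
isConnected {m} g = allF m λ u → allF m λ v → reach g m u v

rot : ∀ {n} → Fin n → Fin n
rot {suc n} i = (toℕ i + suc n / 2) mod suc n

isRotFixed : ∀ {n} → Graph n → Bool
isRotFixed {n} g = allF n λ i → allF n λ j → adj g i j ⇔ᵇ adj g (rot i) (rot j)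

-- contains the edge between the first and the last vertex (1 and m in the paper)
hasEdgeFirstLast : ∀ {m} → Graph m → Bool
hasEdgeFirstLast {zero}  g = false
hasEdgeFirstLast {suc m} g = adj g zero (fromℕ m)

allVecs : ∀ {A : Set} n → List A → List (Vec A n)
allVecs zero    xs = [] ∷ []
allVecs (suc n) xs = concatMap (λ x → map (x ∷_) (allVecs n xs)) xs

allGraphs : ∀ m → List (Graph m)
allGraphs m = allVecs m (allVecs m (true ∷ false ∷ []))

isNCConnected : ∀ {m} → Graph m → ℕ → Bool
isNCConnected g k = isSimple g ∧ isNonCrossing g ∧ isConnected g ∧ (numEdges g ≡ᵇ k)

s₂ : ℕ → ℕ → ℕ
s₂ n k = countB (λ g → isNCConnected g k ∧ isRotFixed g) (allGraphs n)

f : ℕ → ℕ → ℕ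
f m j = countB (λ g → isNCConnected g j ∧ hasEdgeFirstLast g) (allGraphs m)

module Submission where

-- A graph h on the arc 0,…,p containing the diameter {0,p} doubles to a
-- graph on n vertices: h itself plus its rotation by π, placed on the
-- antipodal arc p,…,2p.  The copies share only {0,p}, so the double is
-- simple, non-crossing, connected and rotation-fixed, with 2e(h) − 1 edges.
-- Conversely, no edge of a non-crossing graph crosses a diameter it contains,
-- so a rotation-fixed one containing {0,p} is the double of its half.  An odd
-- number of edges forces a diameter (otherwise rotation pairs up the edges:
-- the parity lemma), and non-crossing graphs have at most one.

open import Defs
open import Data.Bool using (Bool; true; false; _∧_; _∨_; not; T)
import Data.Bool as Bool
open import Data.Bool.ListAction using (all; any)
open import Data.Bool.Properties using (∧-comm; ∧-assoc; ∨-comm; not-involutive)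
open import Data.Unit using (tt)
open import Data.Nat
  using (ℕ; zero; suc; _+_; _*_; _∸_; _≤_; _<_; _/_; _%_; z≤n; s≤s; s≤s⁻¹; _<ᵇ_; _≡ᵇ_; _<?_; _≤?_)
import Data.Nat as ℕ
open import Data.Nat.DivMod
  using (_mod_; m%n<n; m*n/n≡m; n%n≡0; m≡m%n+[m/n]*n; %-distribˡ-+; m%n%n≡m%n; m<n⇒m%n≡m; [m+n]%n≡m%n; [m+kn]%n≡m%n)
open import Data.Nat.Properties
  using ( ≤-antisym; ≤-trans; ≤-reflexive; <-trans; ≤-<-trans; <-≤-trans; <-cmp; <⇒≱; <⇒≤; ≮⇒≥; ≰⇒>; ≤∧≢⇒<
        ; n≤0⇒n≡0; n≢0⇒n>0; suc-injective; m≤n+m; <ᵇ⇒<; <⇒<ᵇ; ≡ᵇ⇒≡; ≡⇒≡ᵇ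
        ; +-suc; +-identityʳ; +-assoc; +-comm; *-suc; *-comm; +-commutativeSemigroup
        ; +-monoʳ-≤; +-monoˡ-≤; +-monoˡ-<; +-monoʳ-<; +-cancelʳ-<; +-cancelʳ-≤; +-cancelʳ-≡
        ; ∸-monoˡ-≤; ∸-+-assoc; m∸n+n≡m; m+n∸n≡m; n∸n≡0; m+[n∸m]≡n )
open import Data.Nat.Tactic.RingSolver using (solve-∀)
open import Algebra.Properties.CommutativeSemigroup +-commutativeSemigroup using (interchange)
open import Data.Nat.ListAction using (sum)
open import Data.Nat.Divisibility using (_∣_; divides; m%n≡0⇒n∣m)
open import Data.Fin using (Fin; zero; suc; toℕ; fromℕ<; fromℕ)
import Data.Fin.Properties as Fin
open import Data.Fin.Properties using (toℕ-injective; toℕ-fromℕ<; toℕ<n; toℕ-fromℕ)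
open import Data.Vec using (Vec; []; _∷_; lookup; tabulate)
open import Data.Vec.Properties using (∷-injective; lookup∘tabulate; tabulate∘lookup; tabulate-cong)
open import Data.List using (List; []; _∷_; _++_; map; concatMap; length; allFin; cartesianProduct)
open import Data.List.Properties using (map-++; map-∘; length-tabulate)
open import Data.List.Membership.Propositional using (_∈_)
open import Data.List.Membership.Propositional.Properties
  using (∈-map⁺; ∈-∃++; ∈-allFin; ∈-cartesianProduct⁺)
open import Data.List.Relation.Unary.Any using (here; there) renaming (any? to anyDec)
open import Data.List.Relation.Unary.All.Properties using (¬Any⇒All¬)
open import Data.List.Relation.Unary.All using ([]; _∷_) renaming (lookup to lookupAll)
open import Data.List.Relation.Unary.Unique.Propositional using (Unique; []; _∷_)
open import Data.List.Relation.Unary.Unique.Propositional.Properties as Unique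
  using (allFin⁺; cartesianProduct⁺)
open import Data.Product using (Σ; ∃; _×_; _,_; proj₁; proj₂; uncurry; swap)
open import Data.Sum using (_⊎_; inj₁; inj₂)
open import Data.Empty using (⊥; ⊥-elim)
open import Function using (_∘_)
open import Relation.Binary.PropositionalEquality
  using (_≡_; _≢_; refl; sym; trans; cong; cong₂; subst; subst₂; module ≡-Reasoning)
open import Relation.Nullary using (yes; no; ¬_)
open import Relation.Binary.Definitions using (tri<; tri≈; tri>)
open ≡-Reasoning

countB-++ : ∀ {A : Set} (p : A → Bool) xs ys → countB p (xs ++ ys) ≡ countB p xs + countB p ys
countB-++ p [] ys = refl
countB-++ p (x ∷ xs) ys with p x
... | true  = cong suc (countB-++ p xs ys)
... | false = countB-++ p xs ys

countB-map : ∀ {A B : Set} (p : B → Bool) (f : A → B) xs → countB p (map f xs) ≡ countB (p ∘ f) xs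
countB-map p f [] = refl
countB-map p f (x ∷ xs) with p (f x)
... | true  = cong suc (countB-map p f xs)
... | false = countB-map p f xs

countB-cong : ∀ {A : Set} {p q : A → Bool} xs → (∀ x → p x ≡ q x) → countB p xs ≡ countB q xs
countB-cong [] e = refl
countB-cong {q = q} (x ∷ xs) e rewrite e x with q x
... | true  = cong suc (countB-cong xs e)
... | false = countB-cong xs e

countB-split : ∀ {A : Set} (p r : A → Bool) xs →
  countB p xs ≡ countB (λ x → p x ∧ r x) xs + countB (λ x → p x ∧ not (r x)) xs
countB-split p r [] = refl
countB-split p r (x ∷ xs) with p x | r x
... | true  | true  = cong suc (countB-split p r xs)
... | true  | false = trans (cong suc (countB-split p r xs)) (sym (+-suc _ _))
... | false | _     = countB-split p r xs

countB-∨ : ∀ {A : Set} (p q : A → Bool) xs →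
  countB (λ x → p x ∨ q x) xs + countB (λ x → p x ∧ q x) xs ≡ countB p xs + countB q xs
countB-∨ p q [] = refl
countB-∨ p q (x ∷ xs) with p x | q x
... | true  | true  = cong suc (trans (+-suc _ _) (trans (cong suc (countB-∨ p q xs)) (sym (+-suc _ _))))
... | true  | false = cong suc (countB-∨ p q xs)
... | false | true  = trans (cong suc (countB-∨ p q xs)) (sym (+-suc _ _))
... | false | false = countB-∨ p q xs

countB-cartesianProduct : ∀ {A B : Set} (p : A × B → Bool) xs ys →
  countB p (cartesianProduct xs ys) ≡ sum (map (λ x → countB (λ y → p (x , y)) ys) xs)
countB-cartesianProduct p [] ys = refl
countB-cartesianProduct p (x ∷ xs) ys = begin
  countB p (map (x ,_) ys ++ cartesianProduct xs ys)
    ≡⟨ countB-++ p (map (x ,_) ys) (cartesianProduct xs ys) ⟩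
  countB p (map (x ,_) ys) + countB p (cartesianProduct xs ys)
    ≡⟨ cong₂ _+_ (countB-map p (x ,_) ys) (countB-cartesianProduct p xs ys) ⟩
  countB (λ y → p (x , y)) ys + sum (map (λ x → countB (λ y → p (x , y)) ys) xs) ∎

sum-map-const : ∀ {A : Set} (xs : List A) c → sum (map (λ _ → c) xs) ≡ length xs * c
sum-map-const [] c = refl
sum-map-const (x ∷ xs) c = cong (c +_) (sum-map-const xs c)

countB-remove : ∀ {A : Set} (q : A → Bool) {y} as bs → q y ≡ true →
  countB q (as ++ y ∷ bs) ≡ suc (countB q (as ++ bs))
countB-remove q [] bs qy rewrite qy = refl
countB-remove q (a ∷ as) bs qy with q a
... | true  = cong suc (countB-remove q as bs qy)
... | false = countB-remove q as bs qy

∈-remove : ∀ {A : Set} {y z : A} as bs → z ∈ as ++ y ∷ bs → z ≢ y → z ∈ as ++ bs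
∈-remove [] bs (here z≡y) z≢y = ⊥-elim (z≢y z≡y)
∈-remove [] bs (there z∈) z≢y = z∈
∈-remove (a ∷ as) bs (here z≡a) z≢y = here z≡a
∈-remove (a ∷ as) bs (there z∈) z≢y = there (∈-remove as bs z∈ z≢y)

count-injection : ∀ {A B : Set} (p : A → Bool) (q : B → Bool) (φ : A → B) (ψ : B → A) →
  (∀ x → p x ≡ true → q (φ x) ≡ true) → (∀ x → p x ≡ true → ψ (φ x) ≡ x) →
  ∀ xs ys → Unique xs → (∀ x → x ∈ xs → p x ≡ true → φ x ∈ ys) → countB p xs ≤ countB q ys
count-injection p q φ ψ pq ψφ [] ys _ _ = z≤n
count-injection p q φ ψ pq ψφ (x ∷ xs) ys (x≢xs ∷ uxs) into with p x in px
... | false = count-injection p q φ ψ pq ψφ xs ys uxs (λ z z∈ → into z (there z∈))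
... | true with ∈-∃++ (into x (here refl) px)
...   | as , bs , refl = subst (suc (countB p xs) ≤_) (sym (countB-remove q as bs (pq x px)))
          (s≤s (count-injection p q φ ψ pq ψφ xs (as ++ bs) uxs into′))
  where
  into′ : ∀ z → z ∈ xs → p z ≡ true → φ z ∈ as ++ bs
  into′ z z∈ pz = ∈-remove as bs (into z (there z∈) pz)
    λ φz≡φx → lookupAll x≢xs z∈ (trans (sym (ψφ x px)) (trans (cong ψ (sym φz≡φx)) (ψφ z pz)))

record Enumeration (A : Set) : Set where
  field
    elems    : List A
    unique   : Unique elems
    complete : ∀ x → x ∈ elems
open Enumeration

record Bijection {A B : Set} (p : A → Bool) (q : B → Bool) : Set where
  field
    to      : A → B
    from    : B → A
    to-ok   : ∀ x → p x ≡ true → q (to x) ≡ true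
    from-ok : ∀ y → q y ≡ true → p (from y) ≡ true
    from-to : ∀ x → p x ≡ true → from (to x) ≡ x
    to-from : ∀ y → q y ≡ true → to (from y) ≡ y

count-bijection : ∀ {A B : Set} (E : Enumeration A) (F : Enumeration B) {p : A → Bool} {q : B → Bool} →
  Bijection p q → countB p (elems E) ≡ countB q (elems F)
count-bijection E F {p} {q} β = ≤-antisym
  (count-injection p q to from to-ok from-to (elems E) (elems F) (unique E) (λ x _ _ → complete F (to x)))
  (count-injection q p from to from-ok to-from (elems F) (elems E) (unique F) (λ y _ _ → complete E (from y)))
  where open Bijection β

count-halves : ∀ {A : Set} (E : Enumeration A) (p r : A → Bool) (σ : A → A) →
  (∀ x → σ (σ x) ≡ x) → (∀ x → p x ≡ true → p (σ x) ≡ true) →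
  (∀ x → p x ≡ true → r (σ x) ≡ not (r x)) →
  countB p (elems E) ≡ countB (λ x → p x ∧ r x) (elems E) + countB (λ x → p x ∧ r x) (elems E)
count-halves E p r σ σσ pσ rσ = trans (countB-split p r (elems E))
  (cong (countB (λ x → p x ∧ r x) (elems E) +_) (count-bijection E E β))
  where
  flip-to : ∀ x → (p x ∧ not (r x)) ≡ true → (p (σ x) ∧ r (σ x)) ≡ true
  flip-to x e with p x in px | r x in rx
  flip-to x () | true | true
  ... | true | false rewrite pσ x px | rσ x px | rx = refl
  flip-from : ∀ x → (p x ∧ r x) ≡ true → (p (σ x) ∧ not (r (σ x))) ≡ true
  flip-from x e with p x in px | r x in rx
  flip-from x () | true | false
  ... | true | true rewrite pσ x px | rσ x px | rx = refl
  β : Bijection (λ x → p x ∧ not (r x)) (λ x → p x ∧ r x)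
  β = record { to = σ ; from = σ ; to-ok = flip-to ; from-ok = flip-from
             ; from-to = λ x _ → σσ x ; to-from = λ x _ → σσ x }

finEnum : ∀ m → Enumeration (Fin m)
finEnum m = record { elems = allFin m ; unique = allFin⁺ m ; complete = ∈-allFin }

boolEnum : Enumeration Bool
boolEnum = record { elems = true ∷ false ∷ [] ; unique = ((λ ()) ∷ []) ∷ [] ∷ [] ; complete = complete′ }
  where
  complete′ : ∀ b → b ∈ true ∷ false ∷ []
  complete′ true  = here refl
  complete′ false = there (here refl)

productEnum : ∀ {A B : Set} → Enumeration A → Enumeration B → Enumeration (A × B)
productEnum E F = record
  { elems = cartesianProduct (elems E) (elems F)
  ; unique = cartesianProduct⁺ (unique E) (unique F)
  ; complete = λ { (x , y) → ∈-cartesianProduct⁺ (complete E x) (complete F y) } }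

conses : ∀ {A : Set} {n} (xs : List A) (L : List (Vec A n)) →
  concatMap (λ x → map (x ∷_) L) xs ≡ map (uncurry _∷_) (cartesianProduct xs L)
conses [] L = refl
conses (x ∷ xs) L = begin
  map (x ∷_) L ++ concatMap (λ x → map (x ∷_) L) xs
    ≡⟨ cong₂ _++_ (map-∘ L) (conses xs L) ⟩
  map (uncurry _∷_) (map (x ,_) L) ++ map (uncurry _∷_) (cartesianProduct xs L)
    ≡⟨ sym (map-++ (uncurry _∷_) (map (x ,_) L) (cartesianProduct xs L)) ⟩
  map (uncurry _∷_) (map (x ,_) L ++ cartesianProduct xs L) ∎

vecEnum : ∀ {A : Set} n → Enumeration A → Enumeration (Vec A n)
vecEnum {A} n E = record { elems = allVecs n (elems E) ; unique = unique′ n ; complete = complete′ n }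
  where
  unique′ : ∀ n → Unique (allVecs n (elems E))
  unique′ zero = [] ∷ []
  unique′ (suc n) rewrite conses (elems E) (allVecs n (elems E)) =
    Unique.map⁺ (λ {x} {y} e → cong₂ _,_ (proj₁ (∷-injective e)) (proj₂ (∷-injective e)))
      (cartesianProduct⁺ (unique E) (unique′ n))
  complete′ : ∀ n (v : Vec A n) → v ∈ allVecs n (elems E)
  complete′ zero [] = here refl
  complete′ (suc n) (x ∷ v) rewrite conses (elems E) (allVecs n (elems E)) =
    ∈-map⁺ (uncurry _∷_) (∈-cartesianProduct⁺ (complete E x) (complete′ n v))

graphEnum : ∀ m → Enumeration (Graph m)
graphEnum m = vecEnum m (vecEnum m boolEnum)

∧-elimˡ : ∀ {a b} → a ∧ b ≡ true → a ≡ true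
∧-elimˡ {true} _ = refl

∧-elimʳ : ∀ {a b} → a ∧ b ≡ true → b ≡ true
∧-elimʳ {true} e = e

∧-intro : ∀ {a b} → a ≡ true → b ≡ true → a ∧ b ≡ true
∧-intro refl refl = refl

∨-introˡ : ∀ {a} b → a ≡ true → a ∨ b ≡ true
∨-introˡ b refl = refl

∨-introʳ : ∀ a {b} → b ≡ true → a ∨ b ≡ true
∨-introʳ true  e = refl
∨-introʳ false e = e

∨-elim : ∀ {a b} → a ∨ b ≡ true → a ≡ true ⊎ b ≡ true
∨-elim {true}  e = inj₁ refl
∨-elim {false} e = inj₂ e

not-elim : ∀ {a} → not a ≡ true → a ≡ false
not-elim {false} _ = refl

not-intro : ∀ {a} → a ≡ false → not a ≡ true
not-intro refl = refl

⇔ᵇ-elim : ∀ {a b} → (a ⇔ᵇ b) ≡ true → a ≡ b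
⇔ᵇ-elim {true}  {true}  _ = refl
⇔ᵇ-elim {false} {false} _ = refl

⇔ᵇ-intro : ∀ {a b} → a ≡ b → (a ⇔ᵇ b) ≡ true
⇔ᵇ-intro {true}  refl = refl
⇔ᵇ-intro {false} refl = refl

bool-ext : ∀ {a b} → (a ≡ true → b ≡ true) → (b ≡ true → a ≡ true) → a ≡ b
bool-ext {true}          f g = sym (f refl)
bool-ext {false} {true}  f g = g refl
bool-ext {false} {false} f g = refl

false≢true : false ≢ true
false≢true ()

<ᵇ-sound : ∀ {m n} → (m <ᵇ n) ≡ true → m < n
<ᵇ-sound {m} {n} e = <ᵇ⇒< m n (subst T (sym e) tt)

<ᵇ-complete : ∀ {m n} → m < n → (m <ᵇ n) ≡ true
<ᵇ-complete {m} {n} l with m <ᵇ n | <⇒<ᵇ l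
... | true | _ = refl

<ᵇ-false : ∀ {m n} → ¬ (m < n) → (m <ᵇ n) ≡ false
<ᵇ-false {m} {n} m≮n with m <ᵇ n in e
... | true  = ⊥-elim (m≮n (<ᵇ-sound e))
... | false = refl

≡ᵇ-sound : ∀ {m n} → (m ≡ᵇ n) ≡ true → m ≡ n
≡ᵇ-sound {m} {n} e = ≡ᵇ⇒≡ m n (subst T (sym e) tt)

≡ᵇ-complete : ∀ {m n} → m ≡ n → (m ≡ᵇ n) ≡ true
≡ᵇ-complete {m} refl with m ≡ᵇ m | ≡⇒≡ᵇ m m refl
... | true | _ = refl

allF-sound : ∀ m (p : Fin m → Bool) → allF m p ≡ true → ∀ i → p i ≡ true
allF-sound m p e i = go (allFin m) e (∈-allFin i)
  where
  go : ∀ xs → all p xs ≡ true → i ∈ xs → p i ≡ true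
  go (x ∷ xs) e (here refl) = ∧-elimˡ e
  go (x ∷ xs) e (there i∈) = go xs (∧-elimʳ {p x} e) i∈

allF-complete : ∀ m (p : Fin m → Bool) → (∀ i → p i ≡ true) → allF m p ≡ true
allF-complete m p h = go (allFin m)
  where
  go : ∀ xs → all p xs ≡ true
  go [] = refl
  go (x ∷ xs) = ∧-intro (h x) (go xs)

anyF-sound : ∀ m (p : Fin m → Bool) → anyF m p ≡ true → ∃ λ i → p i ≡ true
anyF-sound m p = go (allFin m)
  where
  go : ∀ xs → any p xs ≡ true → ∃ λ i → p i ≡ true
  go (x ∷ xs) e with ∨-elim {p x} e
  ... | inj₁ px = x , px
  ... | inj₂ e′ = go xs e′

anyF-complete : ∀ m (p : Fin m → Bool) i → p i ≡ true → anyF m p ≡ true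
anyF-complete m p i pi = go (allFin m) (∈-allFin i)
  where
  go : ∀ xs → i ∈ xs → any p xs ≡ true
  go (x ∷ xs) (here refl) = ∨-introˡ (any p xs) pi
  go (x ∷ xs) (there i∈) = ∨-introʳ (p x) (go xs i∈)

Adj : ℕ → Set
Adj m = Fin m → Fin m → Bool

tabulateGraph : ∀ {m} → Adj m → Graph m
tabulateGraph A = tabulate (λ i → tabulate (A i))

adj-tabulateGraph : ∀ {m} (A : Adj m) i j → adj (tabulateGraph A) i j ≡ A i j
adj-tabulateGraph A i j rewrite lookup∘tabulate (λ i → tabulate (A i)) i = lookup∘tabulate (A i) j

graph-ext : ∀ {m} (g h : Graph m) → (∀ i j → adj g i j ≡ adj h i j) → g ≡ h
graph-ext g h e = begin
  g                                             ≡⟨ tabulate∘lookup g ⟨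
  tabulate (λ i → lookup g i)                   ≡⟨ tabulate-cong row ⟩
  tabulate (λ i → lookup h i)                   ≡⟨ tabulate∘lookup h ⟩
  h                                             ∎
  where
  row : ∀ i → lookup g i ≡ lookup h i
  row i = trans (sym (tabulate∘lookup (lookup g i)))
            (trans (tabulate-cong (e i)) (tabulate∘lookup (lookup h i)))

_≗₂_ : ∀ {m} → Adj m → Adj m → Set
A ≗₂ B = ∀ i j → A i j ≡ B i j

record Simple {m} (A : Adj m) : Set where
  field
    loopless  : ∀ i → A i i ≡ false
    symmetric : ∀ i j → A i j ≡ A j i

NonCrossing : ∀ {m} → Adj m → Set
NonCrossing {m} A = ∀ (a b c d : Fin m) → A a b ≡ true → A c d ≡ true →
  toℕ a < toℕ c → toℕ c < toℕ b → toℕ b < toℕ d → ⊥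

RotationFixed : ∀ {m} → Adj m → Set
RotationFixed A = ∀ i j → A i j ≡ A (rot i) (rot j)

data Walk {m} (A : Adj m) : Fin m → Fin m → Set where
  []  : ∀ {u} → Walk A u u
  _∷_ : ∀ {u w v} → A u w ≡ true → Walk A w v → Walk A u v

Connected : ∀ {m} → Adj m → Set
Connected A = ∀ u v → Walk A u v

record NCConnected {m} (A : Adj m) : Set where
  field
    simple      : Simple A
    nonCrossing : NonCrossing A
    connected   : Connected A

_++ʷ_ : ∀ {m} {A : Adj m} {u v w} → Walk A u v → Walk A v w → Walk A u w
[]       ++ʷ q = q
(e ∷ p) ++ʷ q = e ∷ (p ++ʷ q)

reverseʷ : ∀ {m} {A : Adj m} → (∀ i j → A i j ≡ A j i) → ∀ {u v} → Walk A u v → Walk A v u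
reverseʷ s [] = []
reverseʷ s (_∷_ {u} {w} e p) = reverseʷ s p ++ʷ (trans (s w u) e ∷ [])

mapʷ : ∀ {m m′} {A : Adj m} {B : Adj m′} (f : Fin m → Fin m′) →
  (∀ i j → A i j ≡ true → B (f i) (f j) ≡ true) → ∀ {u v} → Walk A u v → Walk B (f u) (f v)
mapʷ f h [] = []
mapʷ f h (e ∷ p) = h _ _ e ∷ mapʷ f h p

module _ {m} {A B : Adj m} (A≗B : A ≗₂ B) where

  simple-resp : Simple A → Simple B
  simple-resp s = record
    { loopless  = λ i → trans (sym (A≗B i i)) (Simple.loopless s i)
    ; symmetric = λ i j → trans (sym (A≗B i j)) (trans (Simple.symmetric s i j) (A≗B j i)) }

  nonCrossing-resp : NonCrossing A → NonCrossing B
  nonCrossing-resp nc a b c d ab cd = nc a b c d (trans (A≗B a b) ab) (trans (A≗B c d) cd)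

  rotationFixed-resp : RotationFixed A → RotationFixed B
  rotationFixed-resp r i j = trans (sym (A≗B i j)) (trans (r i j) (A≗B _ _))

  connected-resp : Connected A → Connected B
  connected-resp c u v = mapʷ (λ x → x) (λ i j e → trans (sym (A≗B i j)) e) (c u v)

  ncConnected-resp : NCConnected A → NCConnected B
  ncConnected-resp G = record
    { simple = simple-resp simple ; nonCrossing = nonCrossing-resp nonCrossing
    ; connected = connected-resp connected }
    where open NCConnected G

isSimple-sound : ∀ {m} (g : Graph m) → isSimple g ≡ true → Simple (adj g)
isSimple-sound {m} g e = record
  { loopless  = λ i → not-elim (∧-elimˡ (allF-sound m _ e i))
  ; symmetric = λ i j → ⇔ᵇ-elim (allF-sound m _ (∧-elimʳ (allF-sound m _ e i)) j) }

isSimple-complete : ∀ {m} (g : Graph m) → Simple (adj g) → isSimple g ≡ true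
isSimple-complete {m} g s = allF-complete m _ λ i →
  ∧-intro (not-intro (Simple.loopless s i)) (allF-complete m _ λ j → ⇔ᵇ-intro (Simple.symmetric s i j))

crossing-test : ∀ x₁ x₂ x₃ x₄ x₅ → (x₁ ∧ x₂ ∧ x₃ ∧ x₄ ∧ x₅) ≡ true →
  x₁ ≡ true × x₂ ≡ true × x₃ ≡ true × x₄ ≡ true × x₅ ≡ true
crossing-test true true true true true _ = refl , refl , refl , refl , refl

isNonCrossing-sound : ∀ {m} (g : Graph m) → isNonCrossing g ≡ true → NonCrossing (adj g)
isNonCrossing-sound {m} g e a b c d ab cd a<c c<b b<d = false≢true (trans (sym crossing≡false) crossing)
  where
  crossing≡false : (adj g a b ∧ adj g c d ∧ (a <F c) ∧ (c <F b) ∧ (b <F d)) ≡ false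
  crossing≡false = not-elim (allF-sound m _ (allF-sound m _ (allF-sound m _ (allF-sound m _ e a) b) c) d)
  crossing : (adj g a b ∧ adj g c d ∧ (a <F c) ∧ (c <F b) ∧ (b <F d)) ≡ true
  crossing = ∧-intro ab (∧-intro cd (∧-intro (<ᵇ-complete a<c) (∧-intro (<ᵇ-complete c<b) (<ᵇ-complete b<d))))

isNonCrossing-complete : ∀ {m} (g : Graph m) → NonCrossing (adj g) → isNonCrossing g ≡ true
isNonCrossing-complete {m} g nc =
  allF-complete m _ λ a → allF-complete m _ λ b → allF-complete m _ λ c → allF-complete m _ λ d →
    not-intro (no-crossing a b c d)
  where
  no-crossing : ∀ a b c d → (adj g a b ∧ adj g c d ∧ (a <F c) ∧ (c <F b) ∧ (b <F d)) ≡ false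
  no-crossing a b c d with adj g a b ∧ adj g c d ∧ (a <F c) ∧ (c <F b) ∧ (b <F d) in e
  ... | false = refl
  ... | true with crossing-test _ _ _ _ _ e
  ...   | ab , cd , a<c , c<b , b<d = ⊥-elim (nc a b c d ab cd (<ᵇ-sound a<c) (<ᵇ-sound c<b) (<ᵇ-sound b<d))

isRotFixed-sound : ∀ {m} (g : Graph m) → isRotFixed g ≡ true → RotationFixed (adj g)
isRotFixed-sound {m} g e i j = ⇔ᵇ-elim (allF-sound m _ (allF-sound m _ e i) j)

isRotFixed-complete : ∀ {m} (g : Graph m) → RotationFixed (adj g) → isRotFixed g ≡ true
isRotFixed-complete {m} g r = allF-complete m _ λ i → allF-complete m _ λ j → ⇔ᵇ-intro (r i j)

reach-sound : ∀ {m} (g : Graph m) t u v → reach g t u v ≡ true → Walk (adj g) u v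
reach-sound g zero u v e with toℕ-injective {i = u} {j = v} (≡ᵇ-sound e)
... | refl = []
reach-sound {m} g (suc t) u v e with ∨-elim {reach g t u v} e
... | inj₁ e′ = reach-sound g t u v e′
... | inj₂ e′ with anyF-sound m _ e′
...   | w , uw∧wv = reach-sound g t u w (∧-elimˡ uw∧wv) ++ʷ (∧-elimʳ uw∧wv ∷ [])

reach-refl : ∀ {m} (g : Graph m) t u → reach g t u u ≡ true
reach-refl g zero u = ≡ᵇ-complete {toℕ u} refl
reach-refl g (suc t) u = ∨-introˡ _ (reach-refl g t u)

reach-weaken : ∀ {m} (g : Graph m) t d u v → reach g t u v ≡ true → reach g (d + t) u v ≡ true
reach-weaken g t zero u v e = e
reach-weaken g t (suc d) u v e = ∨-introˡ _ (reach-weaken g t d u v e)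

reach-snoc : ∀ {m} (g : Graph m) t u w v → reach g t u w ≡ true → adj g w v ≡ true → reach g (suc t) u v ≡ true
reach-snoc {m} g t u w v uw wv = ∨-introʳ (reach g t u v) (anyF-complete m _ w (∧-intro uw wv))

reach-cons : ∀ {m} (g : Graph m) t u w v → adj g u w ≡ true → reach g t w v ≡ true → reach g (suc t) u v ≡ true
reach-cons g zero u w v uw wv with toℕ-injective {i = w} {j = v} (≡ᵇ-sound wv)
... | refl = reach-snoc g zero u u w (reach-refl g zero u) uw
reach-cons {m} g (suc t) u w v uw wv with ∨-elim {reach g t w v} wv
... | inj₁ e = ∨-introˡ _ (reach-cons g t u w v uw e)
... | inj₂ e with anyF-sound m _ e
...   | x , wx∧xv = reach-snoc g (suc t) u x v (reach-cons g t u w x uw (∧-elimˡ wx∧xv)) (∧-elimʳ wx∧xv)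

data Path {m} (A : Adj m) : Fin m → Fin m → List (Fin m) → Set where
  stop : ∀ {u} → Path A u u (u ∷ [])
  step : ∀ {u w v vs} → A u w ≡ true → Path A w v vs → Path A u v (u ∷ vs)

path-reach : ∀ {m} (g : Graph m) {u v vs} → Path (adj g) u v vs → reach g (length vs) u v ≡ true
path-reach g {u} stop = reach-refl g 1 u
path-reach g (step {u} {w} {v} {vs} e p) = reach-cons g (length vs) u w v e (path-reach g p)

path-suffix : ∀ {m} {A : Adj m} {w v vs} x → Path A w v vs → x ∈ vs → Unique vs →
  Σ (List (Fin m)) λ ws → Path A x v ws × Unique ws
path-suffix x stop       (here refl) u = _ , stop , u
path-suffix x (step e p) (here refl) u = _ , step e p , u
path-suffix x (step e p) (there x∈) (_ ∷ u) = path-suffix x p x∈ u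

shorten : ∀ {m} {A : Adj m} {u v} → Walk A u v → Σ (List (Fin m)) λ vs → Path A u v vs × Unique vs
shorten [] = _ , stop , [] ∷ []
shorten {u = u} (e ∷ p) with shorten p
... | vs , q , uq with anyDec (u Fin.≟_) vs
...   | yes u∈ = path-suffix u q u∈ uq
...   | no  u∉ = _ , step e q , ¬Any⇒All¬ vs u∉ ∷ uq

countB-true : ∀ {A : Set} (xs : List A) → countB (λ _ → true) xs ≡ length xs
countB-true [] = refl
countB-true (x ∷ xs) = cong suc (countB-true xs)

unique-length : ∀ {m} (vs : List (Fin m)) → Unique vs → length vs ≤ m
unique-length {m} vs u = subst₂ _≤_ (countB-true vs) (trans (countB-true (allFin m)) (length-tabulate (λ i → i)))
  (count-injection (λ _ → true) (λ _ → true) (λ x → x) (λ x → x) (λ _ _ → refl) (λ _ _ → refl)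
     vs (allFin m) u (λ x _ _ → ∈-allFin x))

-- A walk shortens to a path, which visits at most m distinct vertices.
walk-reach : ∀ {m} (g : Graph m) u v → Walk (adj g) u v → reach g m u v ≡ true
walk-reach {m} g u v w with shorten w
... | vs , p , uvs = subst (λ t → reach g t u v ≡ true) (m∸n+n≡m (unique-length vs uvs))
        (reach-weaken g (length vs) (m ∸ length vs) u v (path-reach g p))

isConnected-sound : ∀ {m} (g : Graph m) → isConnected g ≡ true → Connected (adj g)
isConnected-sound {m} g e u v = reach-sound g m u v (allF-sound m _ (allF-sound m _ e u) v)

isConnected-complete : ∀ {m} (g : Graph m) → Connected (adj g) → isConnected g ≡ true
isConnected-complete {m} g c = allF-complete m _ λ u → allF-complete m _ λ v → walk-reach g u v (c u v)

isNCConnected-sound : ∀ {m} (g : Graph m) k → isNCConnected g k ≡ true → NCConnected (adj g) × numEdges g ≡ k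
isNCConnected-sound g k e =
  record { simple      = isSimple-sound g (∧-elimˡ e)
         ; nonCrossing = isNonCrossing-sound g (∧-elimˡ e₁)
         ; connected   = isConnected-sound g (∧-elimˡ e₂) }
  , ≡ᵇ-sound (∧-elimʳ {isConnected g} e₂)
  where
  e₁ : (isNonCrossing g ∧ isConnected g ∧ (numEdges g ≡ᵇ k)) ≡ true
  e₁ = ∧-elimʳ {isSimple g} e
  e₂ : (isConnected g ∧ (numEdges g ≡ᵇ k)) ≡ true
  e₂ = ∧-elimʳ {isNonCrossing g} e₁

isNCConnected-complete : ∀ {m} (g : Graph m) k → NCConnected (adj g) → numEdges g ≡ k → isNCConnected g k ≡ true
isNCConnected-complete g k G edges =
  ∧-intro (isSimple-complete g simple) (∧-intro (isNonCrossing-complete g nonCrossing)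
    (∧-intro (isConnected-complete g connected) (≡ᵇ-complete edges)))
  where open NCConnected G

pairEnum : ∀ m → Enumeration (Fin m × Fin m)
pairEnum m = productEnum (finEnum m) (finEnum m)

countPairs : ∀ {m} → Adj m → ℕ
countPairs {m} B = countB (uncurry B) (elems (pairEnum m))

countPairs-cong : ∀ {m} {B C : Adj m} → B ≗₂ C → countPairs B ≡ countPairs C
countPairs-cong {m} B≗C = countB-cong (elems (pairEnum m)) (uncurry B≗C)

numEdges-upper : ∀ {m} (g : Graph m) → numEdges g ≡ countPairs (λ i j → (i <F j) ∧ adj g i j)
numEdges-upper {m} g = sym (countB-cartesianProduct _ (allFin m) (allFin m))

<ᵇ-flip : ∀ a b → a ≢ b → (b <ᵇ a) ≡ not (a <ᵇ b)
<ᵇ-flip a b a≢b with <-cmp a b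
... | tri< a<b _ _ rewrite <ᵇ-complete a<b = <ᵇ-false (<⇒≱ a<b ∘ <⇒≤)
... | tri≈ _ a≡b _ = ⊥-elim (a≢b a≡b)
... | tri> _ _ b<a rewrite <ᵇ-complete b<a | <ᵇ-false (<⇒≱ b<a ∘ <⇒≤) = refl

countPairs-simple : ∀ {m} (A : Adj m) → Simple A →
  countPairs A ≡ countPairs (λ i j → (i <F j) ∧ A i j) + countPairs (λ i j → (i <F j) ∧ A i j)
countPairs-simple {m} A s = trans
  (count-halves (pairEnum m) (uncurry A) (λ { (i , j) → i <F j }) swap (λ _ → refl)
     (λ { (i , j) e → trans (sym (symmetric i j)) e }) flip)
  (cong₂ _+_ upper upper)
  where
  open Simple s
  flip : ∀ x → uncurry A x ≡ true → (proj₂ x <F proj₁ x) ≡ not (proj₁ x <F proj₂ x)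
  flip (i , j) e = <ᵇ-flip (toℕ i) (toℕ j) λ i≡j →
    false≢true (trans (sym (loopless i)) (trans (cong (A i) (toℕ-injective i≡j)) e))
  upper : countB (λ x → uncurry A x ∧ (proj₁ x <F proj₂ x)) (elems (pairEnum m))
        ≡ countPairs (λ i j → (i <F j) ∧ A i j)
  upper = countB-cong (elems (pairEnum m)) λ { (i , j) → ∧-comm (A i j) (i <F j) }

edges-double : ∀ {m} (g : Graph m) → Simple (adj g) → countPairs (adj g) ≡ numEdges g + numEdges g
edges-double g s = trans (countPairs-simple (adj g) s) (cong₂ _+_ (sym (numEdges-upper g)) (sym (numEdges-upper g)))

_⊕_ : ∀ {N} → Fin (suc N) → ℕ → Fin (suc N)
_⊕_ {N} u c = (toℕ u + c) mod suc N

toℕ-⊕ : ∀ {N} (u : Fin (suc N)) c → toℕ (u ⊕ c) ≡ (toℕ u + c) % suc N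
toℕ-⊕ {N} u c = toℕ-fromℕ< (m%n<n (toℕ u + c) (suc N))

⊕-⊕ : ∀ {N} (u : Fin (suc N)) c d → (u ⊕ c) ⊕ d ≡ u ⊕ (c + d)
⊕-⊕ {N} u c d = toℕ-injective (begin
  toℕ ((u ⊕ c) ⊕ d)                       ≡⟨ toℕ-⊕ (u ⊕ c) d ⟩
  (toℕ (u ⊕ c) + d) % suc N              ≡⟨ cong (λ x → (x + d) % suc N) (toℕ-⊕ u c) ⟩
  ((toℕ u + c) % suc N + d) % suc N      ≡⟨ %-distribˡ-+ ((toℕ u + c) % suc N) d (suc N) ⟩
  ((toℕ u + c) % suc N % suc N + d % suc N) % suc N
                                          ≡⟨ cong (λ x → (x + d % suc N) % suc N) (m%n%n≡m%n (toℕ u + c) (suc N)) ⟩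
  ((toℕ u + c) % suc N + d % suc N) % suc N
                                          ≡⟨ %-distribˡ-+ (toℕ u + c) d (suc N) ⟨
  (toℕ u + c + d) % suc N                ≡⟨ cong (_% suc N) (+-assoc (toℕ u) c d) ⟩
  (toℕ u + (c + d)) % suc N              ≡⟨ toℕ-⊕ u (c + d) ⟨
  toℕ (u ⊕ (c + d))                       ∎)

⊕-no-wrap : ∀ {N} (u : Fin (suc N)) c → toℕ u + c < suc N → toℕ (u ⊕ c) ≡ toℕ u + c
⊕-no-wrap u c l = trans (toℕ-⊕ u c) (m<n⇒m%n≡m l)

⊕-wrap : ∀ {N} (u : Fin (suc N)) c → c ≤ suc N → suc N ≤ toℕ u + c → toℕ (u ⊕ c) ≡ toℕ u + c ∸ suc N
⊕-wrap {N} u c c≤ ≤u+c = begin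
  toℕ (u ⊕ c)                                    ≡⟨ toℕ-⊕ u c ⟩
  (toℕ u + c) % suc N                            ≡⟨ cong (_% suc N) (m∸n+n≡m ≤u+c) ⟨
  (toℕ u + c ∸ suc N + suc N) % suc N            ≡⟨ [m+n]%n≡m%n (toℕ u + c ∸ suc N) (suc N) ⟩
  (toℕ u + c ∸ suc N) % suc N                    ≡⟨ m<n⇒m%n≡m (≤-<-trans below (toℕ<n u)) ⟩
  toℕ u + c ∸ suc N                              ∎
  where
  below : toℕ u + c ∸ suc N ≤ toℕ u
  below = ≤-trans (∸-monoˡ-≤ (suc N) (+-monoʳ-≤ (toℕ u) c≤)) (≤-reflexive (m+n∸n≡m (toℕ u) (suc N)))

⊕-zero : ∀ {N} (u : Fin (suc N)) → u ⊕ 0 ≡ u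
⊕-zero u = toℕ-injective
  (trans (⊕-no-wrap u 0 (subst (_< _) (sym (+-identityʳ (toℕ u))) (toℕ<n u))) (+-identityʳ (toℕ u)))

⊕-turns : ∀ {N} (u : Fin (suc N)) k → u ⊕ (k * suc N) ≡ u
⊕-turns {N} u k = toℕ-injective
  (trans (toℕ-⊕ u (k * suc N)) (trans ([m+kn]%n≡m%n (toℕ u) k (suc N)) (m<n⇒m%n≡m (toℕ<n u))))

⊕-full-turn : ∀ {N} (u : Fin (suc N)) → u ⊕ suc N ≡ u
⊕-full-turn {N} u = trans (cong (u ⊕_) (sym (+-identityʳ (suc N)))) (⊕-turns u 1)

-- Shifting by c·N undoes the shift by c.
unshift : ∀ {N} → ℕ → Fin (suc N) → Fin (suc N)
unshift {N} c x = x ⊕ (c * N)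

unshift-⊕ : ∀ {N} c (x : Fin (suc N)) → unshift c x ⊕ c ≡ x
unshift-⊕ {N} c x = trans (⊕-⊕ x (c * N) c) (trans (cong (x ⊕_) (trans (+-comm (c * N) c) (sym (*-suc c N)))) (⊕-turns x c))

⊕-unshift : ∀ {N} c (x : Fin (suc N)) → unshift c (x ⊕ c) ≡ x
⊕-unshift {N} c x = trans (⊕-⊕ x c (c * N)) (trans (cong (x ⊕_) (sym (*-suc c N))) (⊕-turns x c))

-- The graph A with all vertices moved back by c.
shift : ∀ {N} → ℕ → Adj (suc N) → Adj (suc N)
shift c A u v = A (u ⊕ c) (v ⊕ c)

shift-zero : ∀ {N} (A : Adj (suc N)) → shift 0 A ≗₂ A
shift-zero A i j = cong₂ A (⊕-zero i) (⊕-zero j)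

shift-shift : ∀ {N} c d (A : Adj (suc N)) → shift c (shift d A) ≗₂ shift (c + d) A
shift-shift c d A i j = cong₂ A (⊕-⊕ i c d) (⊕-⊕ j c d)

simple-shift : ∀ {N} c {A : Adj (suc N)} → Simple A → Simple (shift c A)
simple-shift c s = record { loopless = λ i → loopless (i ⊕ c) ; symmetric = λ i j → symmetric (i ⊕ c) (j ⊕ c) }
  where open Simple s

rot-⊕ : ∀ {N} (u : Fin (suc N)) c → rot (u ⊕ c) ≡ rot u ⊕ c
rot-⊕ {N} u c = trans (⊕-⊕ u c (suc N / 2)) (trans (cong (u ⊕_) (+-comm c (suc N / 2))) (sym (⊕-⊕ u (suc N / 2) c)))

rotationFixed-shift : ∀ {N} c {A : Adj (suc N)} → RotationFixed A → RotationFixed (shift c A)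
rotationFixed-shift c {A} r i j = trans (r (i ⊕ c) (j ⊕ c)) (cong₂ A (rot-⊕ i c) (rot-⊕ j c))

connected-shift : ∀ {N} c {A : Adj (suc N)} → Connected A → Connected (shift c A)
connected-shift c {A} conn u v = subst₂ (Walk (shift c A)) (⊕-unshift c u) (⊕-unshift c v)
  (mapʷ (unshift c) (λ i j e → trans (cong₂ A (unshift-⊕ c i) (unshift-⊕ c j)) e) (conn (u ⊕ c) (v ⊕ c)))

countPairs-shift : ∀ {N} c (A : Adj (suc N)) → countPairs (shift c A) ≡ countPairs A
countPairs-shift {N} c A = count-bijection (pairEnum (suc N)) (pairEnum (suc N)) record
  { to      = λ { (u , v) → u ⊕ c , v ⊕ c }
  ; from    = λ { (x , y) → unshift c x , unshift c y }
  ; to-ok   = λ _ e → e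
  ; from-ok = λ { (x , y) e → trans (cong₂ A (unshift-⊕ c x) (unshift-⊕ c y)) e }
  ; from-to = λ { (u , v) _ → cong₂ _,_ (⊕-unshift c u) (⊕-unshift c v) }
  ; to-from = λ { (x , y) _ → cong₂ _,_ (unshift-⊕ c x) (unshift-⊕ c y) } }

⊕-one : ∀ {N} (x : Fin (suc N)) → toℕ x < N → toℕ (x ⊕ 1) ≡ suc (toℕ x)
⊕-one {N} x l = trans (⊕-no-wrap x 1 (subst (_< suc N) (sym (+-comm (toℕ x) 1)) (s≤s l))) (+-comm (toℕ x) 1)

⊕-one-last : ∀ {N} (u : Fin (suc N)) → toℕ u ≡ N → toℕ (u ⊕ 1) ≡ 0
⊕-one-last {N} u u≡N =
  trans (⊕-wrap u 1 (s≤s z≤n) (≤-reflexive N+1≡)) (trans (cong (_∸ suc N) (sym N+1≡)) (n∸n≡0 (suc N)))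
  where
  N+1≡ : suc N ≡ toℕ u + 1
  N+1≡ = trans (cong suc (sym u≡N)) (+-comm 1 (toℕ u))

-- Rotating by one vertex keeps a simple graph non-crossing: a crossing of the
-- rotated chords either avoids the last vertex (then it was a crossing before)
-- or uses it as its largest endpoint d, which becomes vertex 0 (then the
-- chords {d,c} and {a,b} crossed before).
nonCrossing-shift₁ : ∀ {N} {A : Adj (suc N)} → Simple A → NonCrossing A → NonCrossing (shift 1 A)
nonCrossing-shift₁ {N} {A} s nc a b c d ab cd a<c c<b b<d with toℕ d ℕ.≟ N
... | no d≢N = nc (a ⊕ 1) (b ⊕ 1) (c ⊕ 1) (d ⊕ 1) ab cd (mono a c a<c c<N) (mono c b c<b b<N) (mono b d b<d d<N)
  where
  d<N = ≤∧≢⇒< (s≤s⁻¹ (toℕ<n d)) d≢N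
  b<N = <-trans b<d d<N
  c<N = <-trans c<b b<N
  mono : ∀ x y → toℕ x < toℕ y → toℕ y < N → toℕ (x ⊕ 1) < toℕ (y ⊕ 1)
  mono x y x<y y<N rewrite ⊕-one x (<-trans x<y y<N) | ⊕-one y y<N = s≤s x<y
... | yes d≡N =
  nc (d ⊕ 1) (c ⊕ 1) (a ⊕ 1) (b ⊕ 1) (trans (Simple.symmetric s (d ⊕ 1) (c ⊕ 1)) cd) ab d′<a′ a′<c′ c′<b′
  where
  b<N = <-≤-trans b<d (s≤s⁻¹ (toℕ<n d))
  c<N = <-trans c<b b<N
  a<N = <-trans a<c c<N
  d′<a′ : toℕ (d ⊕ 1) < toℕ (a ⊕ 1)
  d′<a′ rewrite ⊕-one-last d d≡N | ⊕-one a a<N = s≤s z≤n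
  a′<c′ : toℕ (a ⊕ 1) < toℕ (c ⊕ 1)
  a′<c′ rewrite ⊕-one a a<N | ⊕-one c c<N = s≤s a<c
  c′<b′ : toℕ (c ⊕ 1) < toℕ (b ⊕ 1)
  c′<b′ rewrite ⊕-one c c<N | ⊕-one b b<N = s≤s c<b

nonCrossing-shift : ∀ {N} c {A : Adj (suc N)} → Simple A → NonCrossing A → NonCrossing (shift c A)
nonCrossing-shift zero    {A} s nc = nonCrossing-resp (λ i j → sym (shift-zero A i j)) nc
nonCrossing-shift (suc c) {A} s nc = nonCrossing-resp (shift-shift 1 c A)
  (nonCrossing-shift₁ (simple-shift c s) (nonCrossing-shift c s nc))

ncConnected-shift : ∀ {N} c {A : Adj (suc N)} → NCConnected A → NCConnected (shift c A)
ncConnected-shift c G = record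
  { simple = simple-shift c simple ; nonCrossing = nonCrossing-shift c simple nonCrossing
  ; connected = connected-shift c connected }
  where open NCConnected G

+-self-injective : ∀ a b → a + a ≡ b + b → a ≡ b
+-self-injective zero    zero    e = refl
+-self-injective (suc a) (suc b) e =
  cong suc (+-self-injective a b (suc-injective (trans (sym (+-suc a a)) (trans (suc-injective e) (+-suc b b)))))

-- From here on n = 2p with p = q + 1; vertices are V = Fin n, and the arc
-- 0,…,p is identified with H = Fin (p + 1).
module HalfTurn (q : ℕ) where

  p : ℕ
  p = suc q

  n : ℕ
  n = suc (q + p)

  V : Set
  V = Fin n

  H : Set
  H = Fin (suc p)

  p<n : p < n
  p<n = s≤s (m≤n+m p q)

  half≡ : n / 2 ≡ p
  half≡ = trans (cong (_/ 2) n≡p*2) (m*n/n≡m p 2)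
    where
    n≡p*2 : n ≡ p * 2
    n≡p*2 = trans (cong (p +_) (sym (+-identityʳ p))) (*-comm 2 p)

  rot≡⊕p : ∀ (u : V) → rot u ≡ u ⊕ p
  rot≡⊕p u = cong (u ⊕_) half≡

  antipodal : ∀ {A : Adj n} → RotationFixed A → ∀ u v → A u v ≡ A (u ⊕ p) (v ⊕ p)
  antipodal {A} r u v = trans (r u v) (cong₂ A (rot≡⊕p u) (rot≡⊕p v))

  ⊕p-involutive : ∀ (u : V) → (u ⊕ p) ⊕ p ≡ u
  ⊕p-involutive u = trans (⊕-⊕ u p p) (⊕-full-turn u)

  ⊕p-lower : ∀ (u : V) → toℕ u < p → toℕ (u ⊕ p) ≡ toℕ u + p
  ⊕p-lower u u<p = ⊕-no-wrap u p (+-monoˡ-< p u<p)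

  ⊕p-upper : ∀ (u : V) → p ≤ toℕ u → toℕ (u ⊕ p) ≡ toℕ u ∸ p
  ⊕p-upper u p≤u = trans (⊕-wrap u p (<⇒≤ p<n) (+-monoˡ-≤ p p≤u))
    (trans (sym (∸-+-assoc (toℕ u + p) p p)) (cong (_∸ p) (m+n∸n≡m (toℕ u) p)))

  ⊕p-upper< : ∀ (u : V) → p ≤ toℕ u → toℕ (u ⊕ p) < p
  ⊕p-upper< u p≤u rewrite ⊕p-upper u p≤u = +-cancelʳ-< _ _ p (subst (_< p + p) (sym (m∸n+n≡m p≤u)) (toℕ<n u))

  emb : H → V
  emb a = fromℕ< (≤-<-trans (s≤s⁻¹ (toℕ<n a)) p<n)

  toℕ-emb : ∀ a → toℕ (emb a) ≡ toℕ a
  toℕ-emb a = toℕ-fromℕ< _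

  emb-inArc : ∀ a → toℕ (emb a) ≤ p
  emb-inArc a = subst (_≤ p) (sym (toℕ-emb a)) (s≤s⁻¹ (toℕ<n a))

  -- The position of a vertex on the arc (meaningful for vertices on it).
  cut : V → H
  cut u with toℕ u <? suc p
  ... | yes u≤p = fromℕ< u≤p
  ... | no _    = zero

  toℕ-cut : ∀ u → toℕ u ≤ p → toℕ (cut u) ≡ toℕ u
  toℕ-cut u u≤p with toℕ u <? suc p
  ... | yes l = toℕ-fromℕ< l
  ... | no ¬l = ⊥-elim (¬l (s≤s u≤p))

  cut-emb : ∀ a → cut (emb a) ≡ a
  cut-emb a = toℕ-injective (trans (toℕ-cut (emb a) (emb-inArc a)) (toℕ-emb a))

  emb-cut : ∀ u → toℕ u ≤ p → emb (cut u) ≡ u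
  emb-cut u u≤p = toℕ-injective (trans (toℕ-emb (cut u)) (toℕ-cut u u≤p))

  inArc : V → Bool
  inArc u = toℕ u <ᵇ suc p

  P : V
  P = emb (fromℕ p)

  toℕ-P : toℕ P ≡ p
  toℕ-P = trans (toℕ-emb (fromℕ p)) (toℕ-fromℕ p)

  emb-zero : emb zero ≡ zero
  emb-zero = toℕ-injective (toℕ-emb zero)

  cut-zero : cut zero ≡ zero
  cut-zero = cut-emb zero

  cut-P : cut P ≡ fromℕ p
  cut-P = cut-emb (fromℕ p)

  zero⊕p : zero ⊕ p ≡ P
  zero⊕p = toℕ-injective (trans (⊕p-lower zero (s≤s z≤n)) (sym toℕ-P))

  P⊕p : P ⊕ p ≡ zero
  P⊕p = trans (cong (_⊕ p) (sym zero⊕p)) (⊕p-involutive zero)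

  antiArc-position : ∀ u → toℕ (u ⊕ p) ≤ p → toℕ u ≡ 0 ⊎ p ≤ toℕ u
  antiArc-position u u′≤p with toℕ u <? p
  ... | no  u≮p = inj₂ (≮⇒≥ u≮p)
  ... | yes u<p rewrite ⊕p-lower u u<p = inj₁ (n≤0⇒n≡0 (+-cancelʳ-≤ p (toℕ u) 0 u′≤p))

  arcs-meet : ∀ u → toℕ u ≤ p → toℕ (u ⊕ p) ≤ p → u ≡ zero ⊎ u ≡ P
  arcs-meet u u≤p u′≤p with antiArc-position u u′≤p
  ... | inj₁ u≡0 = inj₁ (toℕ-injective u≡0)
  ... | inj₂ p≤u = inj₂ (toℕ-injective (trans (≤-antisym u≤p p≤u) (sym toℕ-P)))

  copy : Adj (suc p) → Adj n
  copy h u v = inArc u ∧ inArc v ∧ h (cut u) (cut v)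

  double : Adj (suc p) → Adj n
  double h u v = copy h u v ∨ shift p (copy h) u v

  copy-sound : ∀ h u v → copy h u v ≡ true → toℕ u ≤ p × toℕ v ≤ p × h (cut u) (cut v) ≡ true
  copy-sound h u v e = s≤s⁻¹ (<ᵇ-sound (∧-elimˡ e)) , s≤s⁻¹ (<ᵇ-sound (∧-elimˡ e₁)) , ∧-elimʳ {inArc v} e₁
    where
    e₁ : (inArc v ∧ h (cut u) (cut v)) ≡ true
    e₁ = ∧-elimʳ {inArc u} e

  copy-complete : ∀ h u v → toℕ u ≤ p → toℕ v ≤ p → h (cut u) (cut v) ≡ true → copy h u v ≡ true
  copy-complete h u v u≤p v≤p e = ∧-intro (<ᵇ-complete (s≤s u≤p)) (∧-intro (<ᵇ-complete (s≤s v≤p)) e)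

  copy-emb : ∀ h a b → copy h (emb a) (emb b) ≡ h a b
  copy-emb h a b = trans (drop-guards (<ᵇ-complete (s≤s (emb-inArc a))) (<ᵇ-complete (s≤s (emb-inArc b))))
    (cong₂ h (cut-emb a) (cut-emb b))
    where
    drop-guards : ∀ {x y z} → x ≡ true → y ≡ true → (x ∧ y ∧ z) ≡ z
    drop-guards refl refl = refl

  copy-cong : ∀ {h h′} → h ≗₂ h′ → copy h ≗₂ copy h′
  copy-cong h≗h′ u v = cong (λ x → inArc u ∧ inArc v ∧ x) (h≗h′ (cut u) (cut v))

  double-cong : ∀ {h h′} → h ≗₂ h′ → double h ≗₂ double h′
  double-cong h≗h′ u v = cong₂ _∨_ (copy-cong h≗h′ u v) (copy-cong h≗h′ (u ⊕ p) (v ⊕ p))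

  module Doubling (h : Adj (suc p)) (h-simple : Simple h) (h-diameter : h zero (fromℕ p) ≡ true) where

    open Simple h-simple

    copy-simple : Simple (copy h)
    copy-simple = record
      { loopless  = λ u → ∧-zeroʳ-3 (inArc u) (inArc u) (loopless (cut u))
      ; symmetric = λ u v → ∧-swap-3 (inArc u) (inArc v) (symmetric (cut u) (cut v)) }
      where
      ∧-zeroʳ-3 : ∀ a b {c} → c ≡ false → (a ∧ b ∧ c) ≡ false
      ∧-zeroʳ-3 true  true  refl = refl
      ∧-zeroʳ-3 true  false _    = refl
      ∧-zeroʳ-3 false b     _    = refl
      ∧-swap-3 : ∀ a b {c c′} → c ≡ c′ → (a ∧ b ∧ c) ≡ (b ∧ a ∧ c′)
      ∧-swap-3 a b {c} refl = begin
        a ∧ b ∧ c    ≡⟨ ∧-assoc a b c ⟨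
        (a ∧ b) ∧ c  ≡⟨ cong (_∧ c) (∧-comm a b) ⟩
        (b ∧ a) ∧ c  ≡⟨ ∧-assoc b a c ⟩
        b ∧ a ∧ c    ∎

    double-simple : Simple (double h)
    double-simple = record
      { loopless  = λ u → cong₂ _∨_ (loopless′ u) (loopless′ (u ⊕ p))
      ; symmetric = λ u v → cong₂ _∨_ (symmetric′ u v) (symmetric′ (u ⊕ p) (v ⊕ p)) }
      where open Simple copy-simple renaming (loopless to loopless′; symmetric to symmetric′)

    double-rotationFixed : RotationFixed (double h)
    double-rotationFixed u v rewrite rot≡⊕p u | rot≡⊕p v | ⊕p-involutive u | ⊕p-involutive v =
      ∨-comm (copy h u v) (copy h (u ⊕ p) (v ⊕ p))

    copy-nonCrossing : NonCrossing h → NonCrossing (copy h)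
    copy-nonCrossing nc a b c d ab cd a<c c<b b<d
      with copy-sound h a b ab | copy-sound h c d cd
    ... | a≤p , b≤p , ab′ | c≤p , d≤p , cd′ = nc (cut a) (cut b) (cut c) (cut d) ab′ cd′
      (subst₂ _<_ (sym (toℕ-cut a a≤p)) (sym (toℕ-cut c c≤p)) a<c)
      (subst₂ _<_ (sym (toℕ-cut c c≤p)) (sym (toℕ-cut b b≤p)) c<b)
      (subst₂ _<_ (sym (toℕ-cut b b≤p)) (sym (toℕ-cut d d≤p)) b<d)

    -- Chords of the two copies cannot cross: one lies within the arc 0…p,
    -- the other within the antipodal arc p…2p.
    double-nonCrossing : NonCrossing h → NonCrossing (double h)
    double-nonCrossing nc a b c d ab cd a<c c<b b<d with ∨-elim {copy h a b} ab | ∨-elim {copy h c d} cd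
    ... | inj₁ ab′ | inj₁ cd′ = copy-nonCrossing nc a b c d ab′ cd′ a<c c<b b<d
    ... | inj₂ ab′ | inj₂ cd′ = nonCrossing-shift p copy-simple (copy-nonCrossing nc) a b c d ab′ cd′ a<c c<b b<d
    ... | inj₁ ab′ | inj₂ cd′ with antiArc-position c (proj₁ (copy-sound h (c ⊕ p) (d ⊕ p) cd′))
    ...   | inj₁ c≡0 = <⇒≱ a<c (subst (_≤ toℕ a) (sym c≡0) z≤n)
    ...   | inj₂ p≤c = <⇒≱ c<b (≤-trans (proj₁ (proj₂ (copy-sound h a b ab′))) p≤c)
    double-nonCrossing nc a b c d ab cd a<c c<b b<d | inj₂ ab′ | inj₁ cd′
      with antiArc-position b (proj₁ (proj₂ (copy-sound h (a ⊕ p) (b ⊕ p) ab′)))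
    ...   | inj₁ b≡0 = <⇒≱ (<-trans a<c c<b) (subst (_≤ toℕ a) (sym b≡0) z≤n)
    ...   | inj₂ p≤b = <⇒≱ b<d (≤-trans (proj₁ (proj₂ (copy-sound h c d cd′))) p≤b)

    -- Every vertex reaches 0: through the first copy if it lies on the arc,
    -- through the second copy (ending at p, the antipode of 0) otherwise.
    walk-to-zero : Connected h → ∀ u → Walk (double h) u zero
    walk-to-zero conn u with toℕ u ≤? p
    ... | yes u≤p = subst₂ (Walk (double h)) (emb-cut u u≤p) emb-zero
          (mapʷ emb (λ a b e → ∨-introˡ _ (trans (copy-emb h a b) e)) (conn (cut u) zero))
    ... | no  u≰p = subst₂ (Walk (double h)) (trans (cong (_⊕ p) (emb-cut u′ u′≤p)) (⊕p-involutive u)) P⊕p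
          (mapʷ (λ a → emb a ⊕ p) (λ a b e → ∨-introʳ (copy h (emb a ⊕ p) (emb b ⊕ p))
             (trans (cong₂ (copy h) (⊕p-involutive (emb a)) (⊕p-involutive (emb b))) (trans (copy-emb h a b) e)))
             (conn (cut u′) (fromℕ p)))
      where
      u′ : V
      u′ = u ⊕ p
      u′≤p : toℕ u′ ≤ p
      u′≤p = <⇒≤ (⊕p-upper< u (<⇒≤ (≰⇒> u≰p)))

    double-connected : Connected h → Connected (double h)
    double-connected conn u v = walk-to-zero conn u ++ʷ reverseʷ (Simple.symmetric double-simple) (walk-to-zero conn v)

    -- Conversely a walk to 0 in the double projects to a walk in h: an edge of
    -- the second copy leaving the arc starts at 0 or at p, and from p the
    -- diameter leads to 0.
    project : ∀ {x} → Walk (double h) x zero → toℕ x ≤ p → Walk h (cut x) zero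
    project [] _ = subst (λ y → Walk h y zero) (sym cut-zero) []
    project {x} (_∷_ {w = w} e rest) x≤p with ∨-elim {copy h x w} e
    ... | inj₁ e′ = let _ , w≤p , e″ = copy-sound h x w e′ in e″ ∷ project rest w≤p
    ... | inj₂ e′ with arcs-meet x x≤p (proj₁ (copy-sound h (x ⊕ p) (w ⊕ p) e′))
    ...   | inj₁ refl = subst (λ y → Walk h y zero) (sym cut-zero) []
    ...   | inj₂ refl = subst (λ y → Walk h y zero) (sym cut-P) (trans (symmetric (fromℕ p) zero) h-diameter ∷ [])

    connected-of-double : Connected (double h) → Connected h
    connected-of-double conn a b = to-zero a ++ʷ reverseʷ symmetric (to-zero b)
      where
      to-zero : ∀ a → Walk h a zero
      to-zero a = subst (λ y → Walk h y zero) (cut-emb a) (project (conn (emb a) zero) (emb-inArc a))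

    double-ncConnected : NCConnected h → NCConnected (double h)
    double-ncConnected G = record
      { simple = double-simple ; nonCrossing = double-nonCrossing (NCConnected.nonCrossing G)
      ; connected = double-connected (NCConnected.connected G) }

    countPairs-copy : countPairs (copy h) ≡ countPairs h
    countPairs-copy = count-bijection (pairEnum n) (pairEnum (suc p)) record
      { to      = λ { (u , v) → cut u , cut v }
      ; from    = λ { (a , b) → emb a , emb b }
      ; to-ok   = λ { (u , v) e → proj₂ (proj₂ (copy-sound h u v e)) }
      ; from-ok = λ { (a , b) e → trans (copy-emb h a b) e }
      ; from-to = λ { (u , v) e → let u≤p , v≤p , _ = copy-sound h u v e in cong₂ _,_ (emb-cut u u≤p) (emb-cut v v≤p) }
      ; to-from = λ { (a , b) _ → cong₂ _,_ (cut-emb a) (cut-emb b) } }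

    copy-diameter : copy h zero P ≡ true
    copy-diameter = copy-complete h zero P z≤n (≤-reflexive toℕ-P) (trans (cong₂ h cut-zero cut-P) h-diameter)

    -- The two copies share exactly the diameter {0,p}, i.e. two ordered pairs.
    copies-overlap : countPairs (λ u v → copy h u v ∧ shift p (copy h) u v) ≡ 2
    copies-overlap = count-bijection (pairEnum n) boolEnum {q = λ _ → true} record
      { to      = λ { (u , v) → toℕ u ≡ᵇ 0 }
      ; from    = diameter-end
      ; to-ok   = λ _ _ → refl
      ; from-ok = λ { true  _ → ∧-intro copy-diameter (trans (cong₂ (copy h) zero⊕p P⊕p) diameter′)
                    ; false _ → ∧-intro diameter′ (trans (cong₂ (copy h) P⊕p zero⊕p) copy-diameter) }
      ; from-to = λ { (u , v) e → from-to u v e }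
      ; to-from = λ { true _ → refl ; false _ → refl } }
      where
      open Simple copy-simple renaming (loopless to loopless′; symmetric to symmetric′)
      diameter′ : copy h P zero ≡ true
      diameter′ = trans (symmetric′ P zero) copy-diameter
      diameter-end : Bool → V × V
      diameter-end true  = zero , P
      diameter-end false = P , zero
      from-to : ∀ u v → (copy h u v ∧ copy h (u ⊕ p) (v ⊕ p)) ≡ true → diameter-end (toℕ u ≡ᵇ 0) ≡ (u , v)
      from-to u v e with copy-sound h u v (∧-elimˡ e) | copy-sound h (u ⊕ p) (v ⊕ p) (∧-elimʳ {copy h u v} e)
      ... | u≤p , v≤p , _ | u′≤p , v′≤p , _ with arcs-meet u u≤p u′≤p | arcs-meet v v≤p v′≤p
      ... | inj₁ refl | inj₁ refl = ⊥-elim (false≢true (trans (sym (loopless′ zero)) (∧-elimˡ e)))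
      ... | inj₁ refl | inj₂ refl = refl
      ... | inj₂ refl | inj₁ refl = refl
      ... | inj₂ refl | inj₂ refl = ⊥-elim (false≢true (trans (sym (loopless′ P)) (∧-elimˡ e)))

    -- Each copy has the ordered pairs of h; the shared diameter is counted twice.
    double-count : countPairs (double h) + 2 ≡ countPairs h + countPairs h
    double-count = begin
      countPairs (double h) + 2
        ≡⟨ cong (countPairs (double h) +_) copies-overlap ⟨
      countPairs (double h) + countPairs (λ u v → copy h u v ∧ shift p (copy h) u v)
        ≡⟨ countB-∨ (uncurry (copy h)) (uncurry (shift p (copy h))) (elems (pairEnum n)) ⟩
      countPairs (copy h) + countPairs (shift p (copy h))
        ≡⟨ cong₂ _+_ countPairs-copy (trans (countPairs-shift p (copy h)) countPairs-copy) ⟩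
      countPairs h + countPairs h ∎

    -- Restricted to the arc, the double of h is h again: the second copy meets
    -- the arc only in the diameter {0,p}, which h contains.
    double-restrict : ∀ a b → double h (emb a) (emb b) ≡ h a b
    double-restrict a b = bool-ext (restrict a b) (λ e → ∨-introˡ _ (trans (copy-emb h a b) e))
      where
      endpoint : ∀ a → toℕ (emb a ⊕ p) ≤ p → a ≡ zero ⊎ a ≡ fromℕ p
      endpoint a a′≤p with arcs-meet (emb a) (emb-inArc a) a′≤p
      ... | inj₁ a≡0 = inj₁ (trans (sym (cut-emb a)) (trans (cong cut a≡0) cut-zero))
      ... | inj₂ a≡P = inj₂ (trans (sym (cut-emb a)) (trans (cong cut a≡P) cut-P))
      loop-absurd : ∀ {Goal : Set} x → h (cut (emb x ⊕ p)) (cut (emb x ⊕ p)) ≡ true → Goal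
      loop-absurd x e = ⊥-elim (false≢true (trans (sym (loopless _)) e))
      restrict : ∀ a b → double h (emb a) (emb b) ≡ true → h a b ≡ true
      restrict a b e with ∨-elim {copy h (emb a) (emb b)} e
      ... | inj₁ e′ = trans (sym (copy-emb h a b)) e′
      ... | inj₂ e′ with copy-sound h (emb a ⊕ p) (emb b ⊕ p) e′
      ...   | a′≤p , b′≤p , e″ with endpoint a a′≤p | endpoint b b′≤p
      ...     | inj₁ refl | inj₁ refl = loop-absurd zero e″
      ...     | inj₁ refl | inj₂ refl = h-diameter
      ...     | inj₂ refl | inj₁ refl = trans (symmetric _ _) h-diameter
      ...     | inj₂ refl | inj₂ refl = loop-absurd (fromℕ p) e″

  half : Adj n → Adj (suc p)
  half A a b = A (emb a) (emb b)

  module Halving (A : Adj n) (A-simple : Simple A) (A-nonCrossing : NonCrossing A)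
                 (A-rotationFixed : RotationFixed A) (A-diameter : A zero P ≡ true) where

    open Simple A-simple

    half-simple : Simple (half A)
    half-simple = record { loopless = λ a → loopless (emb a) ; symmetric = λ a b → symmetric (emb a) (emb b) }

    half-diameter : half A zero (fromℕ p) ≡ true
    half-diameter = trans (cong (λ x → A x P) emb-zero) A-diameter

    half-nonCrossing : NonCrossing (half A)
    half-nonCrossing a b c d ab cd a<c c<b b<d = A-nonCrossing (emb a) (emb b) (emb c) (emb d) ab cd
      (subst₂ _<_ (sym (toℕ-emb a)) (sym (toℕ-emb c)) a<c)
      (subst₂ _<_ (sym (toℕ-emb c)) (sym (toℕ-emb b)) c<b)
      (subst₂ _<_ (sym (toℕ-emb b)) (sym (toℕ-emb d)) b<d)

    -- No edge joins the open arcs 0 < x < p and p < y: it would cross {0,p}.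
    no-edge-across : ∀ x y → A x y ≡ true → 0 < toℕ x → toℕ x < p → p < toℕ y → ⊥
    no-edge-across x y e 0<x x<p p<y =
      A-nonCrossing zero P x y A-diameter e 0<x (subst (toℕ x <_) (sym toℕ-P) x<p) (subst (_< toℕ y) (sym toℕ-P) p<y)

    off-antiArc : ∀ u → ¬ (toℕ (u ⊕ p) ≤ p) → 0 < toℕ u × toℕ u < p
    off-antiArc u u′≰p with toℕ u <? p
    ... | no  u≮p = ⊥-elim (u′≰p (<⇒≤ (⊕p-upper< u (≮⇒≥ u≮p))))
    ... | yes u<p with toℕ u ℕ.≟ 0
    ...   | yes u≡0 = ⊥-elim (u′≰p (≤-reflexive (trans (⊕p-lower u u<p) (cong (_+ p) u≡0))))
    ...   | no  u≢0 = n≢0⇒n>0 u≢0 , u<p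

    edge-sides : ∀ u v → A u v ≡ true → (toℕ u ≤ p × toℕ v ≤ p) ⊎ (toℕ (u ⊕ p) ≤ p × toℕ (v ⊕ p) ≤ p)
    edge-sides u v e with toℕ u ≤? p | toℕ v ≤? p | toℕ (u ⊕ p) ≤? p | toℕ (v ⊕ p) ≤? p
    ... | yes u≤p | yes v≤p | _         | _         = inj₁ (u≤p , v≤p)
    ... | _       | _       | yes u′≤p  | yes v′≤p  = inj₂ (u′≤p , v′≤p)
    ... | no u≰p  | _       | yes _     | no v′≰p   =
      ⊥-elim (no-edge-across v u (trans (symmetric v u) e)
                (proj₁ (off-antiArc v v′≰p)) (proj₂ (off-antiArc v v′≰p)) (≰⇒> u≰p))
    ... | no u≰p  | _       | no u′≰p   | _         = ⊥-elim (u′≰p (<⇒≤ (⊕p-upper< u (<⇒≤ (≰⇒> u≰p)))))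
    ... | yes _   | no v≰p  | no u′≰p   | _         =
      ⊥-elim (no-edge-across u v e (proj₁ (off-antiArc u u′≰p)) (proj₂ (off-antiArc u u′≰p)) (≰⇒> v≰p))
    ... | yes _   | no v≰p  | yes _     | no v′≰p   = ⊥-elim (v′≰p (<⇒≤ (⊕p-upper< v (<⇒≤ (≰⇒> v≰p)))))

    copy-half-sound : ∀ u v → copy (half A) u v ≡ true → A u v ≡ true
    copy-half-sound u v e with copy-sound (half A) u v e
    ... | u≤p , v≤p , e′ = trans (sym (cong₂ A (emb-cut u u≤p) (emb-cut v v≤p))) e′

    copy-half-complete : ∀ u v → toℕ u ≤ p → toℕ v ≤ p → A u v ≡ true → copy (half A) u v ≡ true
    copy-half-complete u v u≤p v≤p e =
      copy-complete (half A) u v u≤p v≤p (trans (cong₂ A (emb-cut u u≤p) (emb-cut v v≤p)) e)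

    double-half : A ≗₂ double (half A)
    double-half u v = bool-ext to-double from-double
      where
      to-double : A u v ≡ true → double (half A) u v ≡ true
      to-double e with edge-sides u v e
      ... | inj₁ (u≤p , v≤p)   = ∨-introˡ _ (copy-half-complete u v u≤p v≤p e)
      ... | inj₂ (u′≤p , v′≤p) =
        ∨-introʳ _ (copy-half-complete (u ⊕ p) (v ⊕ p) u′≤p v′≤p (trans (sym (antipodal A-rotationFixed u v)) e))
      from-double : double (half A) u v ≡ true → A u v ≡ true
      from-double e with ∨-elim {copy (half A) u v} e
      ... | inj₁ e′ = copy-half-sound u v e′
      ... | inj₂ e′ = trans (antipodal A-rotationFixed u v) (copy-half-sound (u ⊕ p) (v ⊕ p) e′)

    open Doubling (half A) half-simple half-diameter using (connected-of-double; double-count)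

    half-ncConnected : Connected A → NCConnected (half A)
    half-ncConnected conn = record
      { simple = half-simple ; nonCrossing = half-nonCrossing
      ; connected = connected-of-double (connected-resp double-half conn) }

    half-count : countPairs A + 2 ≡ countPairs (half A) + countPairs (half A)
    half-count = trans (cong (_+ 2) (countPairs-cong double-half)) double-count

  lower : Fin p → V
  lower i = fromℕ< (<-trans (toℕ<n i) p<n)

  toℕ-lower : ∀ i → toℕ (lower i) ≡ toℕ i
  toℕ-lower i = toℕ-fromℕ< _

  diameter : Adj n → Fin p → Bool
  diameter A i = A (lower i) (lower i ⊕ p)

  low : V → Bool
  low u = toℕ u <ᵇ p

  low-⊕p : ∀ u → low (u ⊕ p) ≡ not (low u)
  low-⊕p u with toℕ u <? p
  ... | yes u<p rewrite <ᵇ-complete u<p | ⊕p-lower u u<p = <ᵇ-false (λ l → <⇒≱ l (m≤n+m p (toℕ u)))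
  ... | no  u≮p rewrite <ᵇ-false u≮p = <ᵇ-complete (⊕p-upper< u (≮⇒≥ u≮p))

  -- Parity lemma: a rotation-fixed simple graph without diameters has an even
  -- number of edges.  Its ordered edge pairs (u , v) with u in the lower half
  -- are as many as its edges (rotation exchanges the halves); those with v
  -- also low pair up under (u , v) ↦ (v , u), the others under
  -- (u , v) ↦ (v + p , u + p), which has no fixed point as there is no diameter.
  module Parity (A : Adj n) (A-simple : Simple A) (A-rotationFixed : RotationFixed A)
                (no-diameter : ∀ i → diameter A i ≡ false) where

    open Simple A-simple

    pairs : List (V × V)
    pairs = elems (pairEnum n)

    lowFirst : V × V → Bool
    lowFirst z = uncurry A z ∧ low (proj₁ z)

    bothLow : V × V → Bool
    bothLow z = lowFirst z ∧ low (proj₂ z)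

    lowHigh : V × V → Bool
    lowHigh z = lowFirst z ∧ not (low (proj₂ z))

    edges≡lowFirst : countPairs (λ u v → (u <F v) ∧ A u v) ≡ countB lowFirst pairs
    edges≡lowFirst = +-self-injective _ _ (trans (sym (countPairs-simple A A-simple))
      (count-halves (pairEnum n) (uncurry A) (low ∘ proj₁) (λ { (u , v) → u ⊕ p , v ⊕ p })
        (λ { (u , v) → cong₂ _,_ (⊕p-involutive u) (⊕p-involutive v) })
        (λ { (u , v) e → trans (sym (antipodal A-rotationFixed u v)) e })
        (λ { (u , v) _ → low-⊕p u })))

    bothLow-halves : countB bothLow pairs ≡ countB (λ z → bothLow z ∧ (proj₁ z <F proj₂ z)) pairs
                                         + countB (λ z → bothLow z ∧ (proj₁ z <F proj₂ z)) pairs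
    bothLow-halves = count-halves (pairEnum n) bothLow (λ z → proj₁ z <F proj₂ z) swap (λ _ → refl)
      (λ { (u , v) e → swapped u v e })
      (λ { (u , v) e → <ᵇ-flip (toℕ u) (toℕ v) λ u≡v → distinct u v (∧-elimˡ (∧-elimˡ e)) (toℕ-injective u≡v) })
      where
      distinct : ∀ u v → A u v ≡ true → u ≢ v
      distinct u v e refl = false≢true (trans (sym (loopless u)) e)
      swapped : ∀ u v → bothLow (u , v) ≡ true → bothLow (v , u) ≡ true
      swapped u v e = ∧-intro (∧-intro (trans (symmetric v u) (∧-elimˡ (∧-elimˡ e))) (∧-elimʳ {lowFirst (u , v)} e))
                              (∧-elimʳ {A u v} (∧-elimˡ e))

    no-antipodal-edge : ∀ u → low u ≡ true → A u (u ⊕ p) ≡ false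
    no-antipodal-edge u u-low = trans (cong (λ x → A x (x ⊕ p)) (sym lower-i)) (no-diameter i)
      where
      i : Fin p
      i = fromℕ< (<ᵇ-sound u-low)
      lower-i : lower i ≡ u
      lower-i = toℕ-injective (trans (toℕ-lower i) (toℕ-fromℕ< _))

    -- Selector for the involution (u , v) ↦ (v + p , u + p).
    opposite : V × V → Bool
    opposite (u , v) = toℕ (v ⊕ p) <ᵇ toℕ u

    lowHigh-halves : countB lowHigh pairs ≡ countB (λ z → lowHigh z ∧ opposite z) pairs
                                         + countB (λ z → lowHigh z ∧ opposite z) pairs
    lowHigh-halves = count-halves (pairEnum n) lowHigh opposite reflect
      (λ { (u , v) → cong₂ _,_ (⊕p-involutive u) (⊕p-involutive v) })
      (λ { (u , v) e → reflected u v e })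
      (λ { (u , v) e → flip u v e })
      where
      reflect : V × V → V × V
      reflect (u , v) = v ⊕ p , u ⊕ p
      reflected : ∀ u v → lowHigh (u , v) ≡ true → lowHigh (v ⊕ p , u ⊕ p) ≡ true
      reflected u v e = ∧-intro (∧-intro (trans (symmetric (v ⊕ p) (u ⊕ p)) (trans (sym (antipodal A-rotationFixed u v)) uv))
                                         (trans (low-⊕p v) (not-intro v-high)))
                                (trans (cong not (low-⊕p u)) (trans (not-involutive (low u)) u-low))
        where
        uv : A u v ≡ true
        uv = ∧-elimˡ (∧-elimˡ e)
        u-low : low u ≡ true
        u-low = ∧-elimʳ {A u v} (∧-elimˡ e)
        v-high : low v ≡ false
        v-high = not-elim (∧-elimʳ {lowFirst (u , v)} e)
      -- A fixed point would be an edge {u , u + p}.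
      flip : ∀ u v → lowHigh (u , v) ≡ true → opposite (v ⊕ p , u ⊕ p) ≡ not (opposite (u , v))
      flip u v e rewrite ⊕p-involutive u = <ᵇ-flip (toℕ (v ⊕ p)) (toℕ u) λ v′≡u →
        false≢true (trans (sym (no-antipodal-edge u u-low)) (trans (cong (A u) (v≡u+p v′≡u)) uv))
        where
        uv : A u v ≡ true
        uv = ∧-elimˡ (∧-elimˡ e)
        u-low : low u ≡ true
        u-low = ∧-elimʳ {A u v} (∧-elimˡ e)
        v≡u+p : toℕ (v ⊕ p) ≡ toℕ u → u ⊕ p ≡ v
        v≡u+p v′≡u = trans (cong (_⊕ p) (sym (toℕ-injective v′≡u))) (⊕p-involutive v)

    diameter-free-even : Σ ℕ λ m → countPairs (λ u v → (u <F v) ∧ A u v) ≡ m + m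
    diameter-free-even = x + y , (begin
      countPairs (λ u v → (u <F v) ∧ A u v)   ≡⟨ edges≡lowFirst ⟩
      countB lowFirst pairs                    ≡⟨ countB-split lowFirst (low ∘ proj₂) pairs ⟩
      countB bothLow pairs + countB lowHigh pairs ≡⟨ cong₂ _+_ bothLow-halves lowHigh-halves ⟩
      (x + x) + (y + y)                        ≡⟨ interchange x x y y ⟩
      (x + y) + (x + y)                        ∎)
      where
      x y : ℕ
      x = countB (λ z → bothLow z ∧ (proj₁ z <F proj₂ z)) pairs
      y = countB (λ z → lowHigh z ∧ opposite z) pairs

  toℕ-lower⊕p : ∀ i → toℕ (lower i ⊕ p) ≡ toℕ i + p
  toℕ-lower⊕p i = trans (⊕p-lower (lower i) (subst (_< p) (sym (toℕ-lower i)) (toℕ<n i))) (cong (_+ p) (toℕ-lower i))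

  diameters-cross : ∀ {A} → NonCrossing A → ∀ i j → toℕ i < toℕ j →
    diameter A i ≡ true → diameter A j ≡ true → ⊥
  diameters-cross nc i j i<j di dj = nc (lower i) (lower i ⊕ p) (lower j) (lower j ⊕ p) di dj
    (subst₂ _<_ (sym (toℕ-lower i)) (sym (toℕ-lower j)) i<j)
    (subst₂ _<_ (sym (toℕ-lower j)) (sym (toℕ-lower⊕p i)) (<-≤-trans (toℕ<n j) (m≤n+m p (toℕ i))))
    (subst₂ _<_ (sym (toℕ-lower⊕p i)) (sym (toℕ-lower⊕p j)) (+-monoˡ-< p i<j))

  diameter-unique : ∀ {A} → NonCrossing A → ∀ i j → diameter A i ≡ true → diameter A j ≡ true → i ≡ j
  diameter-unique nc i j di dj with <-cmp (toℕ i) (toℕ j)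
  ... | tri< i<j _ _ = ⊥-elim (diameters-cross nc i j i<j di dj)
  ... | tri≈ _ i≡j _ = toℕ-injective i≡j
  ... | tri> _ _ j<i = ⊥-elim (diameters-cross nc j i j<i dj di)

  diameter-exists : ∀ {A} → Simple A → RotationFixed A →
    (∀ m → countPairs (λ u v → (u <F v) ∧ A u v) ≢ m + m) → ∃ λ i → diameter A i ≡ true
  diameter-exists {A} s r odd with Fin.any? (λ i → diameter A i Bool.≟ true)
  ... | yes found = found
  ... | no  none  = ⊥-elim (odd (proj₁ even) (proj₂ even))
    where
    absent : ∀ i → diameter A i ≡ false
    absent i with diameter A i in e
    ... | true  = ⊥-elim (none (i , e))
    ... | false = refl
    even : Σ ℕ λ m → countPairs (λ u v → (u <F v) ∧ A u v) ≡ m + m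
    even = Parity.diameter-free-even A s r absent

  -- The position of the diameter, when there is exactly one.
  findDiameter : Adj n → Fin p
  findDiameter A with Fin.any? (λ i → diameter A i Bool.≟ true)
  ... | yes (i , _) = i
  ... | no  _       = zero

  findDiameter-correct : ∀ {A} → NonCrossing A → ∀ i → diameter A i ≡ true → findDiameter A ≡ i
  findDiameter-correct {A} nc i di with Fin.any? (λ i → diameter A i Bool.≟ true)
  ... | yes (j , dj) = diameter-unique nc j i dj di
  ... | no  none     = ⊥-elim (none (i , di))

  shift-diameter : ∀ (A : Adj n) d → shift (toℕ d) A zero P ≡ diameter A d
  shift-diameter A d = cong₂ A zero↦ P↦
    where
    zero↦ : zero ⊕ toℕ d ≡ lower d
    zero↦ = toℕ-injective (trans (⊕-no-wrap zero (toℕ d) (<-trans (toℕ<n d) p<n)) (sym (toℕ-lower d)))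
    P↦ : P ⊕ toℕ d ≡ lower d ⊕ p
    P↦ = toℕ-injective (trans (⊕-no-wrap P (toℕ d) (subst (λ x → x + toℕ d < n) (sym toℕ-P) (+-monoʳ-< p (toℕ<n d))))
           (trans (cong (_+ toℕ d) toℕ-P) (trans (+-comm p (toℕ d)) (sym (toℕ-lower⊕p d)))))

  edges-of-double : ∀ (g : Graph n) (h : Graph (suc p)) → Simple (adj g) → Simple (adj h) →
    countPairs (adj g) + 2 ≡ countPairs (adj h) + countPairs (adj h) → numEdges g + 1 ≡ numEdges h + numEdges h
  edges-of-double g h g-simple h-simple pairs≡ = +-self-injective _ _ (begin
    (numEdges g + 1) + (numEdges g + 1)                   ≡⟨ two-more (numEdges g) ⟩
    (numEdges g + numEdges g) + 2                         ≡⟨ cong (_+ 2) (edges-double g g-simple) ⟨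
    countPairs (adj g) + 2                                ≡⟨ pairs≡ ⟩
    countPairs (adj h) + countPairs (adj h)               ≡⟨ cong₂ _+_ (edges-double h h-simple) (edges-double h h-simple) ⟩
    (numEdges h + numEdges h) + (numEdges h + numEdges h) ∎)
    where
    two-more : ∀ a → (a + 1) + (a + 1) ≡ (a + a) + 2
    two-more = solve-∀

  module Correspondence (k k′ : ℕ) (k+1≡ : k + 1 ≡ k′ + k′) (k-odd : ∀ m → k ≢ m + m) where

    IsRotational : Graph n → Bool
    IsRotational g = isNCConnected g k ∧ isRotFixed g

    IsRooted : Fin p × Graph (suc p) → Bool
    IsRooted (i , h) = isNCConnected h k′ ∧ hasEdgeFirstLast h

    -- The double of h, turned so that its diameter {0,p} lands on {i, i + p}.
    Φ : Fin p × Graph (suc p) → Graph n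
    Φ (i , h) = tabulateGraph (shift (n ∸ toℕ i) (double (adj h)))

    Ψ : Graph n → Fin p × Graph (suc p)
    Ψ g = findDiameter (adj g) , tabulateGraph (half (shift (toℕ (findDiameter (adj g))) (adj g)))

    module FromRooted (i : Fin p) (h : Graph (suc p)) (rooted : IsRooted (i , h) ≡ true) where

      h-ncConnected : NCConnected (adj h)
      h-ncConnected = proj₁ (isNCConnected-sound h k′ (∧-elimˡ rooted))

      h-edges : numEdges h ≡ k′
      h-edges = proj₂ (isNCConnected-sound h k′ (∧-elimˡ rooted))

      h-simple : Simple (adj h)
      h-simple = NCConnected.simple h-ncConnected

      open Doubling (adj h) h-simple (∧-elimʳ {isNCConnected h k′} rooted)

      c : ℕ
      c = n ∸ toℕ i

      g : Graph n
      g = Φ (i , h)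

      g≗ : adj g ≗₂ shift c (double (adj h))
      g≗ = adj-tabulateGraph _

      g-ncConnected : NCConnected (adj g)
      g-ncConnected = ncConnected-resp (λ u v → sym (g≗ u v)) (ncConnected-shift c (double-ncConnected h-ncConnected))

      g-edges : numEdges g ≡ k
      g-edges = +-cancelʳ-≡ 1 _ _ (begin
        numEdges g + 1            ≡⟨ edges-of-double g h (NCConnected.simple g-ncConnected) h-simple pairs≡ ⟩
        numEdges h + numEdges h   ≡⟨ cong₂ _+_ h-edges h-edges ⟩
        k′ + k′                   ≡⟨ k+1≡ ⟨
        k + 1                     ∎)
        where
        pairs≡ : countPairs (adj g) + 2 ≡ countPairs (adj h) + countPairs (adj h)
        pairs≡ = trans (cong (_+ 2) (trans (countPairs-cong g≗) (countPairs-shift c (double (adj h))))) double-count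

      Φ-valid : IsRotational g ≡ true
      Φ-valid = ∧-intro (isNCConnected-complete g k g-ncConnected g-edges)
        (isRotFixed-complete g (rotationFixed-resp (λ u v → sym (g≗ u v)) (rotationFixed-shift c double-rotationFixed)))

      i+c≡n : toℕ i + c ≡ n
      i+c≡n = m+[n∸m]≡n (<⇒≤ (<-trans (toℕ<n i) p<n))

      lower↦zero : lower i ⊕ c ≡ zero
      lower↦zero = toℕ-injective (trans (toℕ-⊕ (lower i) c)
        (trans (cong (λ x → (x + c) % n) (toℕ-lower i)) (trans (cong (_% n) i+c≡n) (n%n≡0 n))))

      upper↦P : (lower i ⊕ p) ⊕ c ≡ P
      upper↦P = begin
        (lower i ⊕ p) ⊕ c    ≡⟨ ⊕-⊕ (lower i) p c ⟩
        lower i ⊕ (p + c)    ≡⟨ cong (lower i ⊕_) (+-comm p c) ⟩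
        lower i ⊕ (c + p)    ≡⟨ ⊕-⊕ (lower i) c p ⟨
        (lower i ⊕ c) ⊕ p    ≡⟨ cong (_⊕ p) lower↦zero ⟩
        zero ⊕ p             ≡⟨ zero⊕p ⟩
        P                    ∎

      g-diameter : diameter (adj g) i ≡ true
      g-diameter = trans (g≗ (lower i) (lower i ⊕ p))
        (trans (cong₂ (double (adj h)) lower↦zero upper↦P) (∨-introˡ _ copy-diameter))

      Ψ-Φ : Ψ g ≡ (i , h)
      Ψ-Φ = cong₂ _,_ found (graph-ext _ h λ a b → begin
        adj (tabulateGraph (half (shift (toℕ (findDiameter (adj g))) (adj g)))) a b
          ≡⟨ adj-tabulateGraph (half (shift (toℕ (findDiameter (adj g))) (adj g))) a b ⟩
        adj g (emb a ⊕ toℕ (findDiameter (adj g))) (emb b ⊕ toℕ (findDiameter (adj g)))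
          ≡⟨ cong (λ d → adj g (emb a ⊕ toℕ d) (emb b ⊕ toℕ d)) found ⟩
        adj g (emb a ⊕ toℕ i) (emb b ⊕ toℕ i)
          ≡⟨ g≗ (emb a ⊕ toℕ i) (emb b ⊕ toℕ i) ⟩
        double (adj h) ((emb a ⊕ toℕ i) ⊕ c) ((emb b ⊕ toℕ i) ⊕ c)
          ≡⟨ cong₂ (double (adj h)) (turn-back a) (turn-back b) ⟩
        double (adj h) (emb a) (emb b)
          ≡⟨ double-restrict a b ⟩
        adj h a b ∎)
        where
        found : findDiameter (adj g) ≡ i
        found = findDiameter-correct (NCConnected.nonCrossing g-ncConnected) i g-diameter
        turn-back : ∀ a → (emb a ⊕ toℕ i) ⊕ c ≡ emb a
        turn-back a = trans (⊕-⊕ (emb a) (toℕ i) c) (trans (cong (emb a ⊕_) i+c≡n) (⊕-full-turn (emb a)))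

    module FromRotational (g : Graph n) (rotational : IsRotational g ≡ true) where

      g-ncConnected : NCConnected (adj g)
      g-ncConnected = proj₁ (isNCConnected-sound g k (∧-elimˡ rotational))

      g-edges : numEdges g ≡ k
      g-edges = proj₂ (isNCConnected-sound g k (∧-elimˡ rotational))

      g-simple : Simple (adj g)
      g-simple = NCConnected.simple g-ncConnected

      g-rotationFixed : RotationFixed (adj g)
      g-rotationFixed = isRotFixed-sound g (∧-elimʳ {isNCConnected g k} rotational)

      -- k is odd, so g has a diameter; d is its position.
      d : Fin p
      d = findDiameter (adj g)

      d-diameter : diameter (adj g) d ≡ true
      d-diameter with diameter-exists g-simple g-rotationFixed odd
        where
        odd : ∀ m → countPairs (λ u v → (u <F v) ∧ adj g u v) ≢ m + m
        odd m e = k-odd m (trans (sym g-edges) (trans (numEdges-upper g) e))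
      ... | i , di = subst (λ j → diameter (adj g) j ≡ true)
                       (sym (findDiameter-correct (NCConnected.nonCrossing g-ncConnected) i di)) di

      A : Adj n
      A = shift (toℕ d) (adj g)

      A-ncConnected : NCConnected A
      A-ncConnected = ncConnected-shift (toℕ d) g-ncConnected

      open Halving A (NCConnected.simple A-ncConnected) (NCConnected.nonCrossing A-ncConnected)
                   (rotationFixed-shift (toℕ d) g-rotationFixed) (trans (shift-diameter (adj g) d) d-diameter)

      h : Graph (suc p)
      h = tabulateGraph (half A)

      h≗ : adj h ≗₂ half A
      h≗ = adj-tabulateGraph (half A)

      h-ncConnected : NCConnected (adj h)
      h-ncConnected = ncConnected-resp (λ a b → sym (h≗ a b)) (half-ncConnected (NCConnected.connected A-ncConnected))

      h-edges : numEdges h ≡ k′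
      h-edges = +-self-injective _ _ (begin
        numEdges h + numEdges h   ≡⟨ edges-of-double g h g-simple (NCConnected.simple h-ncConnected) pairs≡ ⟨
        numEdges g + 1            ≡⟨ cong (_+ 1) g-edges ⟩
        k + 1                     ≡⟨ k+1≡ ⟩
        k′ + k′                   ∎)
        where
        pairs≡ : countPairs (adj g) + 2 ≡ countPairs (adj h) + countPairs (adj h)
        pairs≡ = trans (cong (_+ 2) (sym (countPairs-shift (toℕ d) (adj g))))
                   (trans half-count (cong₂ _+_ (sym (countPairs-cong h≗)) (sym (countPairs-cong h≗))))

      Ψ-valid : IsRooted (Ψ g) ≡ true
      Ψ-valid = ∧-intro (isNCConnected-complete h k′ h-ncConnected h-edges) (trans (h≗ zero (fromℕ p)) half-diameter)

      Φ-Ψ : Φ (Ψ g) ≡ g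
      Φ-Ψ = graph-ext _ g λ u v → begin
        adj (Φ (d , h)) u v                          ≡⟨ adj-tabulateGraph (shift c (double (adj h))) u v ⟩
        double (adj h) (u ⊕ c) (v ⊕ c)               ≡⟨ double-cong h≗ (u ⊕ c) (v ⊕ c) ⟩
        double (half A) (u ⊕ c) (v ⊕ c)              ≡⟨ double-half (u ⊕ c) (v ⊕ c) ⟨
        adj g ((u ⊕ c) ⊕ toℕ d) ((v ⊕ c) ⊕ toℕ d)    ≡⟨ cong₂ (adj g) (turn-back u) (turn-back v) ⟩
        adj g u v                                    ∎
        where
        c : ℕ
        c = n ∸ toℕ d
        turn-back : ∀ u → (u ⊕ c) ⊕ toℕ d ≡ u
        turn-back u = trans (⊕-⊕ u c (toℕ d))
          (trans (cong (u ⊕_) (m∸n+n≡m (<⇒≤ (<-trans (toℕ<n d) p<n)))) (⊕-full-turn u))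

    s₂≡ : s₂ n k ≡ p * f (suc p) k′
    s₂≡ = begin
      s₂ n k
        ≡⟨ count-bijection (graphEnum n) (productEnum (finEnum p) (graphEnum (suc p))) correspondence ⟩
      countB IsRooted (cartesianProduct (allFin p) (allGraphs (suc p)))
        ≡⟨ countB-cartesianProduct IsRooted (allFin p) (allGraphs (suc p)) ⟩
      sum (map (λ _ → f (suc p) k′) (allFin p))
        ≡⟨ sum-map-const (allFin p) (f (suc p) k′) ⟩
      length (allFin p) * f (suc p) k′
        ≡⟨ cong (_* f (suc p) k′) (length-tabulate {n = p} (λ i → i)) ⟩
      p * f (suc p) k′ ∎
      where
      correspondence : Bijection IsRotational IsRooted
      correspondence = record
        { to = Ψ ; from = Φ
        ; to-ok   = FromRotational.Ψ-valid
        ; from-ok = λ { (i , h) → FromRooted.Φ-valid i h }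
        ; from-to = FromRotational.Φ-Ψ
        ; to-from = λ { (i , h) → FromRooted.Ψ-Φ i h } }

odd-not-double : ∀ k → ¬ (2 ∣ k) → ∀ m → k ≢ m + m
odd-not-double k ¬2∣k m k≡m+m = ¬2∣k (divides m (trans k≡m+m (double≡*2 m)))
  where
  double≡*2 : ∀ m → m + m ≡ m * 2
  double≡*2 = solve-∀

odd-succ-halves : ∀ k → ¬ (2 ∣ k) → k + 1 ≡ (k + 1) / 2 + (k + 1) / 2
odd-succ-halves k ¬2∣k = begin
  k + 1                      ≡⟨ k+1≡ ⟩
  suc (k / 2) * 2            ≡⟨ *2≡double (suc (k / 2)) ⟩
  suc (k / 2) + suc (k / 2)  ≡⟨ cong (λ x → x + x) half ⟨
  (k + 1) / 2 + (k + 1) / 2  ∎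
  where
  k%2≡1 : k % 2 ≡ 1
  k%2≡1 with k % 2 | m%n<n k 2 | m%n≡0⇒n∣m k 2
  ... | zero        | _               | 2∣k = ⊥-elim (¬2∣k (2∣k refl))
  ... | suc zero    | _               | _   = refl
  ... | suc (suc _) | s≤s (s≤s ())    | _
  succ : ∀ r → 1 + r * 2 + 1 ≡ suc r * 2
  succ = solve-∀
  *2≡double : ∀ r → r * 2 ≡ r + r
  *2≡double = solve-∀
  k+1≡ : k + 1 ≡ suc (k / 2) * 2
  k+1≡ = trans (cong (_+ 1) (trans (m≡m%n+[m/n]*n k 2) (cong (_+ k / 2 * 2) k%2≡1))) (succ (k / 2))
  half : (k + 1) / 2 ≡ suc (k / 2)
  half = trans (cong (_/ 2) k+1≡) (m*n/n≡m (suc (k / 2)) 2)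

-- With n = 2(q + 1) this is the count of the correspondence.
mainTheorem4 : (n k : ℕ) → 2 ∣ n → 2 < n → ¬ (2 ∣ k) → n ∸ 1 ≤ k → k ≤ 2 * n ∸ 3 →
    s₂ n k ≡ (n / 2) * f (n / 2 + 1) ((k + 1) / 2)
mainTheorem4 n k (divides zero    refl) () _ _ _
mainTheorem4 n k (divides (suc q) refl) _ ¬2∣k _ _ = begin
  s₂ (suc q * 2) k
    ≡⟨ cong (λ m → s₂ m k) (n≡ q) ⟩
  s₂ (HalfTurn.n q) k
    ≡⟨ Correspondence.s₂≡ k ((k + 1) / 2) (odd-succ-halves k ¬2∣k) (odd-not-double k ¬2∣k) ⟩
  suc q * f (suc (suc q)) ((k + 1) / 2)
    ≡⟨ cong₂ (λ a b → a * f b ((k + 1) / 2)) (sym half) (sym (trans (cong (_+ 1) half) (+-comm (suc q) 1))) ⟩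
  (suc q * 2 / 2) * f (suc q * 2 / 2 + 1) ((k + 1) / 2) ∎
  where
  open HalfTurn q using (module Correspondence)
  n≡ : ∀ r → suc r * 2 ≡ suc (r + suc r)
  n≡ = solve-∀
  half : suc q * 2 / 2 ≡ suc q
  half = m*n/n≡m (suc q) 2
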